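{- Let $\mathcal N$ be an orchard network on $X$ with vertex set $V$, and let $v_1,\dots,v_t$ be a fixed labelling of the vertices of $V-X$. For distinct $i,j$, the vertices $v_i$ and $v_j$ are clones if and only if one of the following holds: (i) $v_i$ and $v_j$ belong to the same sink of $\mathcal N$; or (ii) exactly one of $v_i,v_j$ is a reticulation, say $v_i$, and there is a reticulation $v_k$ in the same sink as $v_i$ such that $(v_k,v_j)$ is a (tree) arc of $\mathcal N$.
   Context: A phylogenetic network on a non-empty finite set $X$ is a rooted acyclic directed graph with no parallel arcs such that: (i) the unique root has in-degree $0$ and out-degree $2$; (ii) every vertex of out-degree $0$ has in-degree $1$, and the set of vertices of out-degree $0$ (the leaves) is $X$; (iii) every other vertex either has in-degree $1$ and out-degree $2$ (a tree vertex) or in-degree at least $2$ and out-degree $1$ (a reticulation). If $|X|=1$, a single vertex is also allowed. If $(u,v)$ is an arc, $u$ is a parent of $v$; arcs into reticulations are reticulation arcs, all other arcs are tree arcs. A 2-element subset $\{a,b\}\subseteq X$ with parents $p_a,p_b$ is a cherry if $p_a=p_b$; it is a reticulated cherry with reticulation leaf $b$ if $p_b$ is a reticulation and $(p_a,p_b)$ is an arc. Reducing $b$ in a cherry: delete $b$ and suppress the resulting in-degree-1 out-degree-1 vertex (if the common parent is the root, delete $b$ and the root). Cutting a reticulated cherry $\{a,b\}$: delete the arc $(p_a,p_b)$ and suppress any resulting in-degree-1 out-degree-1 vertices. A phylogenetic network is orchard if some sequence of these cherry reductions transforms it into a single vertex. For $x\in X$ let $\sigma_i(x)$ be the number of directed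 paths from $v_i$ to $x$. Distinct $v_i,v_j$ are clones if $\sigma_i(x)=\sigma_j(x)$ for all $x\in X$. Sinks: on $V-X$ define $u\sim' v$ if $u,v$ are reticulations and $(u,v)$ or $(v,u)$ is an arc; the equivalence classes of the reflexive–transitive closure of $\sim'$ are the sinks. -}

module Defs where

open import Data.Nat using (ℕ; zero; suc; _+_; _*_; _≤_; _<_)
open import Data.Fin using (Fin; _≟_)
import Data.Fin as F
open import Data.Bool using (Bool; true; false; if_then_else_; _∧_; _∨_; not)
open import Data.Product using (Σ; ∃; _×_; _,_)
open import Data.Sum using (_⊎_)
open import Relation.Nullary using (¬_)
open import Relation.Nullary.Decidable using (⌊_⌋)
open import Relation.Binary.PropositionalEquality using (_≡_; _≢_)

-- Finite directed graphs on vertex set Fin n, given by an adjacency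
-- predicate (Boolean: hence no parallel arcs).

Graph : ℕ → Set
Graph n = Fin n → Fin n → Bool

countF : ∀ {n} → (Fin n → Bool) → ℕ
countF {zero}  f = 0
countF {suc n} f = (if f F.zero then 1 else 0) + countF (λ i → f (F.suc i))

sumF : ∀ {n} → (Fin n → ℕ) → ℕ
sumF {zero}  f = 0
sumF {suc n} f = f F.zero + sumF (λ i → f (F.suc i))

_==_ : ∀ {n} → Fin n → Fin n → Bool
u == v = ⌊ u ≟ v ⌋

module _ {n : ℕ} (E : Graph n) where

  Arc : Fin n → Fin n → Set
  Arc u v = E u v ≡ true

  indeg outdeg : Fin n → ℕ
  indeg  v = countF (λ u → E u v)
  outdeg u = countF (λ v → E u v)

  data Reach⁺ : Fin n → Fin n → Set where
    one  : ∀ {u v} → Arc u v → Reach⁺ u v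
    cons : ∀ {u w v} → Arc u w → Reach⁺ w v → Reach⁺ u v

  Acyclic : Set
  Acyclic = ∀ u → ¬ Reach⁺ u u

  IsLeaf : Fin n → Set
  IsLeaf v = outdeg v ≡ 0

  IsRet : Fin n → Set
  IsRet v = 2 ≤ indeg v

  -- phylogenetic network (on X = the set of out-degree-0 vertices)
  IsPhyloNet : Set
  IsPhyloNet = Acyclic ×
    ( (n ≡ 1 × (∀ u v → E u v ≡ false))
    ⊎ Σ (Fin n) (λ ρ → indeg ρ ≡ 0 × outdeg ρ ≡ 2 ×
        (∀ v → v ≢ ρ →
             (outdeg v ≡ 0 × indeg v ≡ 1)
           ⊎ (indeg v ≡ 1 × outdeg v ≡ 2)
           ⊎ (2 ≤ indeg v × outdeg v ≡ 1))))

  walks : ℕ → Fin n → Fin n → ℕ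
  walks zero    u x = if u == x then 1 else 0
  walks (suc l) u x = sumF (λ w → (if E u w then 1 else 0) * walks l w x)

  -- σ(u)(x): number of directed paths from u to x.  In an acyclic graph
  -- on n vertices every walk is a path and has length < n.
  σ : Fin n → Fin n → ℕ
  σ u x = sumF {n} (λ l → walks (F.toℕ l) u x)

  Clones : Fin n → Fin n → Set
  Clones u v = ∀ x → IsLeaf x → σ u x ≡ σ v x

  _~'_ : Fin n → Fin n → Set
  u ~' v = IsRet u × IsRet v × (Arc u v ⊎ Arc v u)

  data SameSink : Fin n → Fin n → Set where
    refl' : ∀ {u} → SameSink u u
    step  : ∀ {u v w} → u ~' v → SameSink v w → SameSink u w

-- Cherry reductions, on states with a fixed ambient vertex set Fin n,
-- a set of alive vertices, and arcs (only between alive vertices).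

record St (n : ℕ) : Set where
  constructor st
  field
    alive : Fin n → Bool
    arc   : Graph n
open St public

module _ {n : ℕ} where

  delV : Fin n → St n → St n
  delV w s = st (λ v → if v == w then false else alive s v)
                (λ u v → arc s u v ∧ not (u == w) ∧ not (v == w))

  delA : Fin n → Fin n → St n → St n
  delA p q s = st (alive s) (λ u v → arc s u v ∧ not ((u == p) ∧ (v == q)))

  addA : Fin n → Fin n → St n → St n
  addA p c s = st (alive s) (λ u v → arc s u v ∨ ((u == p) ∧ (v == c)))

  -- suppress w, whose unique parent is p and unique child is c
  suppress : Fin n → Fin n → Fin n → St n → St n
  suppress w p c s = addA p c (delV w s)

  Alive : St n → Fin n → Set
  Alive s v = alive s v ≡ true

  LeafS : St n → Fin n → Set
  LeafS s v = Alive s v × outdeg (arc s) v ≡ 0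

  data SuppressAll : St n → St n → Set where
    finished : ∀ {s} →
      (∀ w → Alive s w → ¬ (indeg (arc s) w ≡ 1 × outdeg (arc s) w ≡ 1)) →
      SuppressAll s s
    supp : ∀ {s s'} w p c →
      Alive s w → indeg (arc s) w ≡ 1 → outdeg (arc s) w ≡ 1 →
      Arc (arc s) p w → Arc (arc s) w c →
      SuppressAll (suppress w p c s) s' → SuppressAll s s'

  data Reduce : St n → St n → Set where
    cherry : ∀ {s s'} a b p → a ≢ b → LeafS s a → LeafS s b →
      Arc (arc s) p a → Arc (arc s) p b → ¬ (indeg (arc s) p ≡ 0) →
      SuppressAll (delV b s) s' → Reduce s s'
    cherryRoot : ∀ {s} a b p → a ≢ b → LeafS s a → LeafS s b →
      Arc (arc s) p a → Arc (arc s) p b → indeg (arc s) p ≡ 0 →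
      Reduce s (delV p (delV b s))
    cut : ∀ {s s'} a b pa pb → a ≢ b → LeafS s a → LeafS s b →
      Arc (arc s) pa a → Arc (arc s) pb b → IsRet (arc s) pb →
      Arc (arc s) pa pb →
      SuppressAll (delA pa pb s) s' → Reduce s s'

  data Reduces : St n → St n → Set where
    []  : ∀ {s} → Reduces s s
    _∷_ : ∀ {s t u} → Reduce s t → Reduces t u → Reduces s u

  SingleVertex : St n → Set
  SingleVertex s = Σ (Fin n) (λ v → Alive s v × (∀ u → Alive s u → u ≡ v))

  initSt : Graph n → St n
  initSt E = st (λ _ → true) E

  IsOrchard : Graph n → Set
  IsOrchard E = IsPhyloNet E ×
    Σ (St n) (λ s → Reduces (initSt E) s × SingleVertex s)

-- A reticulation has a single child, hence is a clone of it. Following these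
-- children from any vertex v ends at a non-reticulation t(v), a clone of v, and
-- two reticulations end at the same t exactly when they lie in one sink, because
-- t has a single parent. So it suffices that distinct non-reticulations are never
-- clones. For leaves this is immediate from σ(x, y) = [x = y]. For tree vertices
-- we argue along the cherry reductions: the path counts satisfy the recursion
-- σ(u, x) = [u = x] + Σ_{u→w} σ(w, x), which determines them on acyclic graphs and
-- so tracks how deleting a leaf, cutting an arc and suppressing a vertex change
-- σ. A reduction keeps every other tree vertex and all clone relations between
-- them, while the top P of the reduced cherry {a, b} cannot be a clone of a tree
-- vertex w: each child of w would reach b, giving σ(w, b) ≥ 2 > σ(P, b).

module Submission where

open import Defs
open import Data.Nat using (ℕ)
open import Data.Fin using (Fin)
open import Data.Product using (Σ; _×_)
open import Data.Sum using (_⊎_)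
open import Function.Bundles using (_⇔_)
open import Relation.Nullary using (¬_)
open import Relation.Binary.PropositionalEquality using (_≢_)

open import Data.Bool using (Bool; true; false; if_then_else_; _∧_; _∨_; not)
open import Data.Bool.Properties using (∧-identityʳ; ∧-zeroʳ; ∨-identityʳ; ∨-zeroʳ; ∧-conicalˡ)
open import Data.Empty using (⊥; ⊥-elim)
open import Data.Fin using (zero; suc; toℕ; _≟_)
open import Data.Fin.Properties using (pigeonhole; suc-injective)
open import Data.Nat using (zero; suc; _+_; _*_; _≤_; _<_; z≤n; s≤s; _≤?_)
open import Data.Nat.Properties hiding (_≟_; suc-injective)
open import Data.Nat.Tactic.RingSolver using (solve-∀)
open import Data.Product using (_,_; proj₁; proj₂)
open import Data.Sum using (inj₁; inj₂; [_,_]′)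
open import Function.Bundles using (mk⇔)
open import Relation.Nullary using (yes; no)
open import Relation.Binary.PropositionalEquality
  using (_≡_; refl; sym; trans; cong; cong₂; subst; subst₂; ≢-sym; module ≡-Reasoning)
open import Algebra.Properties.Semiring.Sum +-*-semiring
  using (sum; ∑-distrib-+; ∑-comm; *-distribˡ-sum)

⟦_⟧ : Bool → ℕ
⟦ b ⟧ = if b then 1 else 0

case-≟ : ∀ {n} {P : Set} (u v : Fin n) → (u ≡ v → P) → (u ≢ v → P) → P
case-≟ u v same different with u ≟ v
... | yes u≡v = same u≡v
... | no u≢v  = different u≢v

==-refl : ∀ {n} (u : Fin n) → (u == u) ≡ true
==-refl u with u ≟ u
... | yes _   = refl
... | no u≢u = ⊥-elim (u≢u refl)

==-≢ : ∀ {n} {u v : Fin n} → u ≢ v → (u == v) ≡ false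
==-≢ {u = u} {v} u≢v with u ≟ v
... | yes u≡v = ⊥-elim (u≢v u≡v)
... | no _    = refl

==-sym : ∀ {n} (u v : Fin n) → (u == v) ≡ (v == u)
==-sym u v = case-≟ u v (λ { refl → refl })
  (λ u≢v → trans (==-≢ u≢v) (sym (==-≢ (λ v≡u → u≢v (sym v≡u)))))

false≢true : false ≢ true
false≢true ()

sumF-cong : ∀ {n} {f g : Fin n → ℕ} → (∀ i → f i ≡ g i) → sumF f ≡ sumF g
sumF-cong {zero}  f≗g = refl
sumF-cong {suc n} f≗g = cong₂ _+_ (f≗g zero) (sumF-cong (λ i → f≗g (suc i)))

sumF≡sum : ∀ {n} (f : Fin n → ℕ) → sumF f ≡ sum f
sumF≡sum {zero}  f = refl
sumF≡sum {suc n} f = cong (f zero +_) (sumF≡sum (λ i → f (suc i)))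

sumF-+ : ∀ {n} (f g : Fin n → ℕ) → sumF (λ i → f i + g i) ≡ sumF f + sumF g
sumF-+ f g = begin
  sumF (λ i → f i + g i) ≡⟨ sumF≡sum (λ i → f i + g i) ⟩
  sum (λ i → f i + g i)  ≡⟨ ∑-distrib-+ f g ⟩
  sum f + sum g          ≡⟨ sym (cong₂ _+_ (sumF≡sum f) (sumF≡sum g)) ⟩
  sumF f + sumF g        ∎
  where open ≡-Reasoning

sumF-*ˡ : ∀ {n} c (f : Fin n → ℕ) → sumF (λ i → c * f i) ≡ c * sumF f
sumF-*ˡ c f = begin
  sumF (λ i → c * f i) ≡⟨ sumF≡sum (λ i → c * f i) ⟩
  sum (λ i → c * f i)  ≡⟨ sym (*-distribˡ-sum c f) ⟩
  c * sum f            ≡⟨ cong (c *_) (sym (sumF≡sum f)) ⟩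
  c * sumF f           ∎
  where open ≡-Reasoning

sumF-*ʳ : ∀ {n} (f : Fin n → ℕ) c → sumF (λ i → f i * c) ≡ sumF f * c
sumF-*ʳ f c = trans (sumF-cong (λ i → *-comm (f i) c)) (trans (sumF-*ˡ c f) (*-comm c _))

sumF-comm : ∀ {m n} (f : Fin m → Fin n → ℕ) →
            sumF (λ i → sumF (λ j → f i j)) ≡ sumF (λ j → sumF (λ i → f i j))
sumF-comm f = begin
  sumF (λ i → sumF (λ j → f i j)) ≡⟨ sumF²≡sum² f ⟩
  sum (λ i → sum (λ j → f i j))   ≡⟨ ∑-comm f ⟩
  sum (λ j → sum (λ i → f i j))   ≡⟨ sym (sumF²≡sum² (λ j i → f i j)) ⟩
  sumF (λ j → sumF (λ i → f i j)) ∎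
  where
    open ≡-Reasoning
    sumF²≡sum² : ∀ {k l} (g : Fin k → Fin l → ℕ) →
                 sumF (λ i → sumF (g i)) ≡ sum (λ i → sum (g i))
    sumF²≡sum² g = trans (sumF-cong (λ i → sumF≡sum (g i))) (sumF≡sum (λ i → sum (g i)))

sumF-zero : ∀ {n} → sumF {n} (λ _ → 0) ≡ 0
sumF-zero {zero}  = refl
sumF-zero {suc n} = sumF-zero {n}

sumF-exchange : ∀ {n} (z : Fin n) (f g : Fin n → ℕ) →
                (∀ y → y ≢ z → f y ≡ g y) → sumF f + g z ≡ sumF g + f z
sumF-exchange {suc n} zero f g f≗g = begin
  f zero + sumF (λ i → f (suc i)) + g zero
    ≡⟨ cong (λ t → f zero + t + g zero) (sumF-cong (λ i → f≗g (suc i) (λ ()))) ⟩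
  f zero + sumF (λ i → g (suc i)) + g zero
    ≡⟨ swap-outer (f zero) (sumF (λ i → g (suc i))) (g zero) ⟩
  g zero + sumF (λ i → g (suc i)) + f zero ∎
  where
    open ≡-Reasoning
    swap-outer : ∀ a b c → a + b + c ≡ c + b + a
    swap-outer = solve-∀
sumF-exchange {suc n} (suc z) f g f≗g = begin
  f zero + sumF (λ i → f (suc i)) + g (suc z)   ≡⟨ +-assoc (f zero) _ _ ⟩
  f zero + (sumF (λ i → f (suc i)) + g (suc z)) ≡⟨ cong₂ _+_ (f≗g zero (λ ())) tail-exchange ⟩
  g zero + (sumF (λ i → g (suc i)) + f (suc z)) ≡⟨ sym (+-assoc (g zero) _ _) ⟩
  g zero + sumF (λ i → g (suc i)) + f (suc z)   ∎
  where
    open ≡-Reasoning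
    tail-exchange : sumF (λ i → f (suc i)) + g (suc z) ≡ sumF (λ i → g (suc i)) + f (suc z)
    tail-exchange = sumF-exchange z (λ i → f (suc i)) (λ i → g (suc i))
                      (λ y y≢z → f≗g (suc y) (λ e → y≢z (suc-injective e)))

erase : ∀ {n} → Fin n → (Fin n → ℕ) → Fin n → ℕ
erase z f y = if y == z then 0 else f y

erase-≢ : ∀ {n} {z y : Fin n} (f : Fin n → ℕ) → y ≢ z → erase z f y ≡ f y
erase-≢ f y≢z rewrite ==-≢ y≢z = refl

erase-self : ∀ {n} (z : Fin n) (f : Fin n → ℕ) → erase z f z ≡ 0
erase-self z f rewrite ==-refl z = refl

sumF-erase : ∀ {n} (z : Fin n) (f : Fin n → ℕ) → sumF f ≡ sumF (erase z f) + f z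
sumF-erase z f = begin
  sumF f                   ≡⟨ sym (+-identityʳ _) ⟩
  sumF f + 0               ≡⟨ cong (sumF f +_) (sym (erase-self z f)) ⟩
  sumF f + erase z f z     ≡⟨ sumF-exchange z f (erase z f) (λ y y≢z → sym (erase-≢ f y≢z)) ⟩
  sumF (erase z f) + f z   ∎
  where open ≡-Reasoning

sumF-support₁ : ∀ {n} (a : Fin n) (f : Fin n → ℕ) →
                (∀ y → y ≢ a → f y ≡ 0) → sumF f ≡ f a
sumF-support₁ {n} a f vanish = begin
  sumF f                    ≡⟨ sym (+-identityʳ _) ⟩
  sumF f + 0                ≡⟨ sumF-exchange a f (λ _ → 0) vanish ⟩
  sumF {n} (λ _ → 0) + f a  ≡⟨ cong (_+ f a) (sumF-zero {n}) ⟩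
  f a                       ∎
  where open ≡-Reasoning

sumF-support₂ : ∀ {n} (a b : Fin n) (f : Fin n → ℕ) → a ≢ b →
                (∀ y → y ≢ a → y ≢ b → f y ≡ 0) → sumF f ≡ f a + f b
sumF-support₂ a b f a≢b vanish = begin
  sumF f                  ≡⟨ sumF-erase a f ⟩
  sumF (erase a f) + f a  ≡⟨ cong (_+ f a) (sumF-support₁ b (erase a f) erased-vanish) ⟩
  erase a f b + f a       ≡⟨ cong (_+ f a) (erase-≢ f (≢-sym a≢b)) ⟩
  f b + f a               ≡⟨ +-comm (f b) (f a) ⟩
  f a + f b               ∎
  where
    open ≡-Reasoning
    erased-vanish : ∀ y → y ≢ b → erase a f y ≡ 0
    erased-vanish y y≢b = case-≟ y a (λ { refl → erase-self a f })
                                     (λ y≢a → trans (erase-≢ f y≢a) (vanish y y≢a y≢b))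

term≤sumF : ∀ {n} (a : Fin n) (f : Fin n → ℕ) → f a ≤ sumF f
term≤sumF a f rewrite sumF-erase a f = m≤n+m (f a) _

two-terms≤sumF : ∀ {n} (a b : Fin n) (f : Fin n → ℕ) → a ≢ b → f a + f b ≤ sumF f
two-terms≤sumF a b f a≢b rewrite sumF-erase a f | +-comm (f a) (f b) =
  +-monoˡ-≤ (f a) (subst (_≤ sumF (erase a f)) (erase-≢ f (≢-sym a≢b)) (term≤sumF b (erase a f)))

three-terms≤sumF : ∀ {n} (a b c : Fin n) (f : Fin n → ℕ) → a ≢ b → a ≢ c → b ≢ c →
                   f a + f b + f c ≤ sumF f
three-terms≤sumF a b c f a≢b a≢c b≢c rewrite sumF-erase a f =
  subst (_≤ sumF (erase a f) + f a) rearrange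
        (+-monoˡ-≤ (f a) (two-terms≤sumF b c (erase a f) b≢c))
  where
    rearrange : erase a f b + erase a f c + f a ≡ f a + f b + f c
    rearrange rewrite erase-≢ f (≢-sym a≢b) | erase-≢ f (≢-sym a≢c) =
      trans (+-comm (f b + f c) (f a)) (sym (+-assoc (f a) (f b) (f c)))

sumF-agree-off₂ : ∀ {n} (a b : Fin n) (f g : Fin n → ℕ) → a ≢ b →
                  (∀ y → y ≢ a → y ≢ b → f y ≡ g y) → f a + f b ≡ g a + g b →
                  sumF f ≡ sumF g
sumF-agree-off₂ a b f g a≢b f≗g ab-sums = begin
  sumF f                                      ≡⟨ split f ⟩
  sumF (erase b (erase a f)) + (f b + f a)    ≡⟨ cong₂ _+_ (sumF-cong erased-agree) pair ⟩
  sumF (erase b (erase a g)) + (g b + g a)    ≡⟨ sym (split g) ⟩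
  sumF g                                      ∎
  where
    open ≡-Reasoning
    split : ∀ h → sumF h ≡ sumF (erase b (erase a h)) + (h b + h a)
    split h = begin
      sumF h                                             ≡⟨ sumF-erase a h ⟩
      sumF (erase a h) + h a                             ≡⟨ cong (_+ h a) (sumF-erase b (erase a h)) ⟩
      sumF (erase b (erase a h)) + erase a h b + h a     ≡⟨ cong (λ t → sumF (erase b (erase a h)) + t + h a)
                                                               (erase-≢ h (≢-sym a≢b)) ⟩
      sumF (erase b (erase a h)) + h b + h a             ≡⟨ +-assoc (sumF (erase b (erase a h))) _ _ ⟩
      sumF (erase b (erase a h)) + (h b + h a)           ∎
    pair : f b + f a ≡ g b + g a
    pair = trans (+-comm (f b) (f a)) (trans ab-sums (+-comm (g a) (g b)))
    erased-agree : ∀ y → erase b (erase a f) y ≡ erase b (erase a g) y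
    erased-agree y with y ≟ b
    ... | yes _ = refl
    ... | no y≢b with y ≟ a
    ...   | yes _   = refl
    ...   | no y≢a = f≗g y y≢a y≢b

sumF-positive : ∀ {n} (f : Fin n → ℕ) → 0 < sumF f → Σ (Fin n) (λ i → 0 < f i)
sumF-positive {suc n} f positive with f zero in eq
... | suc _ = zero , subst (0 <_) (sym eq) (s≤s z≤n)
... | zero with sumF-positive (λ i → f (suc i)) positive
...   | i , fi>0 = suc i , fi>0

countF≡sumF : ∀ {n} (f : Fin n → Bool) → countF f ≡ sumF (λ i → ⟦ f i ⟧)
countF≡sumF {zero}  f = refl
countF≡sumF {suc n} f = cong (⟦ f zero ⟧ +_) (countF≡sumF (λ i → f (suc i)))

countF-cong : ∀ {n} (f g : Fin n → Bool) → (∀ y → f y ≡ g y) → countF f ≡ countF g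
countF-cong f g f≗g =
  trans (countF≡sumF f) (trans (sumF-cong (λ y → cong ⟦_⟧ (f≗g y))) (sym (countF≡sumF g)))

all-false⇒countF≡0 : ∀ {n} (f : Fin n → Bool) → (∀ y → f y ≡ false) → countF f ≡ 0
all-false⇒countF≡0 {zero}  f all-false = refl
all-false⇒countF≡0 {suc n} f all-false rewrite all-false zero =
  all-false⇒countF≡0 (λ i → f (suc i)) (λ i → all-false (suc i))

true⇒1≤countF : ∀ {n} (f : Fin n → Bool) c → f c ≡ true → 1 ≤ countF f
true⇒1≤countF f c fc rewrite countF≡sumF f =
  subst (_≤ sumF (λ i → ⟦ f i ⟧)) (cong ⟦_⟧ fc) (term≤sumF c (λ i → ⟦ f i ⟧))

two-true⇒2≤countF : ∀ {n} (f : Fin n → Bool) a b → a ≢ b → f a ≡ true → f b ≡ true → 2 ≤ countF f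
two-true⇒2≤countF f a b a≢b fa fb rewrite countF≡sumF f =
  subst (_≤ sumF (λ i → ⟦ f i ⟧)) (cong₂ _+_ (cong ⟦_⟧ fa) (cong ⟦_⟧ fb))
        (two-terms≤sumF a b (λ i → ⟦ f i ⟧) a≢b)

countF≡0⇒false : ∀ {n} (f : Fin n → Bool) → countF f ≡ 0 → ∀ c → f c ≡ false
countF≡0⇒false f count≡0 c with f c in fc
... | false = refl
... | true  = ⊥-elim (1+n≰n (subst (1 ≤_) count≡0 (true⇒1≤countF f c fc)))

1≤countF⇒true : ∀ {n} (f : Fin n → Bool) → 1 ≤ countF f → Σ (Fin n) (λ c → f c ≡ true)
1≤countF⇒true f 1≤count rewrite countF≡sumF f with sumF-positive (λ i → ⟦ f i ⟧) 1≤count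
... | c , positive with f c in fc
...   | true = c , fc

2≤countF⇒two-true : ∀ {n} (f : Fin n → Bool) → 2 ≤ countF f →
                    Σ (Fin n) λ c₁ → Σ (Fin n) λ c₂ → c₁ ≢ c₂ × f c₁ ≡ true × f c₂ ≡ true
2≤countF⇒two-true {suc n} f 2≤count with f zero in f0
... | false with 2≤countF⇒two-true (λ i → f (suc i)) 2≤count
...   | c₁ , c₂ , c₁≢c₂ , fc₁ , fc₂ = suc c₁ , suc c₂ , (λ e → c₁≢c₂ (suc-injective e)) , fc₁ , fc₂
2≤countF⇒two-true {suc n} f (s≤s 1≤count) | true with 1≤countF⇒true (λ i → f (suc i)) 1≤count
...   | c , fc = zero , suc c , (λ ()) , f0 , fc

countF≡1⇒unique : ∀ {n} (f : Fin n → Bool) → countF f ≡ 1 →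
                  ∀ a c → f a ≡ true → f c ≡ true → c ≡ a
countF≡1⇒unique f count≡1 a c fa fc = case-≟ c a (λ c≡a → c≡a) λ c≢a →
  ⊥-elim (1+n≰n (subst (2 ≤_) count≡1 (two-true⇒2≤countF f a c (≢-sym c≢a) fa fc)))

countF≡2⇒one-of : ∀ {n} (f : Fin n → Bool) → countF f ≡ 2 → ∀ a b c → a ≢ b →
                  f a ≡ true → f b ≡ true → f c ≡ true → c ≡ a ⊎ c ≡ b
countF≡2⇒one-of f count≡2 a b c a≢b fa fb fc with c ≟ a | c ≟ b
... | yes c≡a | _       = inj₁ c≡a
... | no _    | yes c≡b = inj₂ c≡b
... | no c≢a  | no c≢b  =
  ⊥-elim (1+n≰n (subst (3 ≤_) (trans (sym (countF≡sumF f)) count≡2)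
    (subst (_≤ sumF (λ i → ⟦ f i ⟧))
      (cong₂ _+_ (cong₂ _+_ (cong ⟦_⟧ fa) (cong ⟦_⟧ fb)) (cong ⟦_⟧ fc))
      (three-terms≤sumF a b c (λ i → ⟦ f i ⟧) a≢b (≢-sym c≢a) (≢-sym c≢b)))))

countF-exchange₁ : ∀ {n} (f g : Fin n → Bool) z → (∀ y → y ≢ z → f y ≡ g y) →
                  countF f + ⟦ g z ⟧ ≡ countF g + ⟦ f z ⟧
countF-exchange₁ f g z f≗g = begin
  countF f + ⟦ g z ⟧               ≡⟨ cong (_+ ⟦ g z ⟧) (countF≡sumF f) ⟩
  sumF (λ y → ⟦ f y ⟧) + ⟦ g z ⟧   ≡⟨ sumF-exchange z _ _ (λ y y≢z → cong ⟦_⟧ (f≗g y y≢z)) ⟩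
  sumF (λ y → ⟦ g y ⟧) + ⟦ f z ⟧   ≡⟨ cong (_+ ⟦ f z ⟧) (sym (countF≡sumF g)) ⟩
  countF g + ⟦ f z ⟧               ∎
  where open ≡-Reasoning

countF-exchange₂ : ∀ {n} (a b : Fin n) (f g : Fin n → Bool) → a ≢ b →
                  f a ≡ true → g a ≡ false → f b ≡ false → g b ≡ true →
                  (∀ y → y ≢ a → y ≢ b → f y ≡ g y) → countF f ≡ countF g
countF-exchange₂ a b f g a≢b fa ga fb gb f≗g = begin
  countF f              ≡⟨ countF≡sumF f ⟩
  sumF (λ i → ⟦ f i ⟧)  ≡⟨ sumF-agree-off₂ a b _ _ a≢b (λ y y≢a y≢b → cong ⟦_⟧ (f≗g y y≢a y≢b))
                             (trans (cong₂ _+_ (cong ⟦_⟧ fa) (cong ⟦_⟧ fb))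
                                    (sym (cong₂ _+_ (cong ⟦_⟧ ga) (cong ⟦_⟧ gb)))) ⟩
  sumF (λ i → ⟦ g i ⟧)  ≡⟨ sym (countF≡sumF g) ⟩
  countF g              ∎
  where open ≡-Reasoning

⟦true⟧* : ∀ {b} m → b ≡ true → ⟦ b ⟧ * m ≡ m
⟦true⟧* m refl = +-identityʳ m

sumWhere : ∀ {n} → (Fin n → Bool) → (Fin n → ℕ) → ℕ
sumWhere f h = sumF (λ y → ⟦ f y ⟧ * h y)

sumWhere-none : ∀ {n} (f : Fin n → Bool) (h : Fin n → ℕ) → (∀ y → f y ≡ false) → sumWhere f h ≡ 0
sumWhere-none {n} f h none = trans (sumF-cong (λ y → cong (λ b → ⟦ b ⟧ * h y) (none y))) (sumF-zero {n})

sumWhere-one : ∀ {n} (f : Fin n → Bool) (h : Fin n → ℕ) c → f c ≡ true →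
               (∀ y → f y ≡ true → y ≡ c) → sumWhere f h ≡ h c
sumWhere-one f h c fc only-c =
  trans (sumF-support₁ c _ vanish) (⟦true⟧* (h c) fc)
  where
    vanish : ∀ y → y ≢ c → ⟦ f y ⟧ * h y ≡ 0
    vanish y y≢c with f y in fy
    ... | false = refl
    ... | true  = ⊥-elim (y≢c (only-c y fy))

sumWhere-two : ∀ {n} (f : Fin n → Bool) (h : Fin n → ℕ) a b → a ≢ b → f a ≡ true → f b ≡ true →
               (∀ y → f y ≡ true → y ≡ a ⊎ y ≡ b) → sumWhere f h ≡ h a + h b
sumWhere-two f h a b a≢b fa fb only-ab =
  trans (sumF-support₂ a b _ a≢b vanish) (cong₂ _+_ (⟦true⟧* (h a) fa) (⟦true⟧* (h b) fb))
  where
    vanish : ∀ y → y ≢ a → y ≢ b → ⟦ f y ⟧ * h y ≡ 0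
    vanish y y≢a y≢b with f y in fy
    ... | false = refl
    ... | true with only-ab y fy
    ...   | inj₁ y≡a = ⊥-elim (y≢a y≡a)
    ...   | inj₂ y≡b = ⊥-elim (y≢b y≡b)

term≤sumWhere : ∀ {n} (f : Fin n → Bool) (h : Fin n → ℕ) a → f a ≡ true → h a ≤ sumWhere f h
term≤sumWhere f h a fa =
  subst (_≤ sumWhere f h) (⟦true⟧* (h a) fa) (term≤sumF a (λ y → ⟦ f y ⟧ * h y))

two-terms≤sumWhere : ∀ {n} (f : Fin n → Bool) (h : Fin n → ℕ) a b → a ≢ b →
                     f a ≡ true → f b ≡ true → h a + h b ≤ sumWhere f h
two-terms≤sumWhere f h a b a≢b fa fb =
  subst (_≤ sumWhere f h) (cong₂ _+_ (⟦true⟧* (h a) fa) (⟦true⟧* (h b) fb))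
        (two-terms≤sumF a b (λ y → ⟦ f y ⟧ * h y) a≢b)

sumWhere-positive : ∀ {n} (f : Fin n → Bool) (h : Fin n → ℕ) → 0 < sumWhere f h →
                    Σ (Fin n) (λ y → f y ≡ true × 0 < h y)
sumWhere-positive f h positive with sumF-positive (λ y → ⟦ f y ⟧ * h y) positive
... | y , term>0 with f y in fy
...   | true = y , fy , subst (0 <_) (+-identityʳ (h y)) term>0

module _ {n : ℕ} {E : Graph n} where

  reach-trans : ∀ {u v w} → Reach⁺ E u v → Reach⁺ E v w → Reach⁺ E u w
  reach-trans (one uv)    vw = cons uv vw
  reach-trans (cons uy r) vw = cons uy (reach-trans r vw)

  reach-unsnoc : ∀ {u v} → Reach⁺ E u v → Σ (Fin n) (λ y → (u ≡ y ⊎ Reach⁺ E u y) × Arc E y v)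
  reach-unsnoc (one uv) = _ , inj₁ refl , uv
  reach-unsnoc (cons uw r) with reach-unsnoc r
  ... | y , inj₁ refl , yv = y , inj₂ (one uw) , yv
  ... | y , inj₂ wy   , yv = y , inj₂ (cons uw wy) , yv

  arc⇒¬leaf : ∀ {w c x} → Arc E w c → IsLeaf E x → w ≢ x
  arc⇒¬leaf {w} {c} wc leaf refl = 1+n≰n (subst (1 ≤_) leaf (true⇒1≤countF (E w) c wc))

  arc-irreflexive : Acyclic E → ∀ {u v} → Arc E u v → u ≢ v
  arc-irreflexive acyclic uv refl = acyclic _ (one uv)

  data Walk : ℕ → Fin n → Set where
    []  : ∀ {u} → Walk 0 u
    _∷_ : ∀ {k u w} → Arc E u w → Walk k w → Walk (suc k) u

  vertexAt : ∀ {k u} → Walk k u → Fin (suc k) → Fin n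
  vertexAt {u = u} []       _       = u
  vertexAt {u = u} (_ ∷ W)  zero    = u
  vertexAt         (_ ∷ W)  (suc i) = vertexAt W i

  vertexAt-zero : ∀ {k u} (W : Walk k u) → vertexAt W zero ≡ u
  vertexAt-zero []      = refl
  vertexAt-zero (_ ∷ _) = refl

  walk-reach : ∀ {k u} (W : Walk k u) (i j : Fin (suc k)) →
               toℕ i < toℕ j → Reach⁺ E (vertexAt W i) (vertexAt W j)
  walk-reach (uw ∷ W) zero    (suc zero)    _ rewrite vertexAt-zero W = one uw
  walk-reach (uw ∷ W) zero    (suc (suc j)) _ =
    cons uw (subst (λ t → Reach⁺ E t (vertexAt W (suc j))) (vertexAt-zero W)
                   (walk-reach W zero (suc j) (s≤s z≤n)))
  walk-reach (_ ∷ W)  (suc i) (suc j) (s≤s i<j) = walk-reach W i j i<j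

  acyclic⇒no-walk : Acyclic E → ∀ {u} → ¬ Walk n u
  acyclic⇒no-walk acyclic W with pigeonhole (n<1+n n) (vertexAt W)
  ... | i , j , i<j , same = acyclic _ (subst (Reach⁺ E (vertexAt W i)) (sym same) (walk-reach W i j i<j))

sumBelow : ℕ → (ℕ → ℕ) → ℕ
sumBelow k g = sumF {k} (λ l → g (toℕ l))

sumBelow-suc : ∀ k g → sumBelow (suc k) g ≡ sumBelow k g + g k
sumBelow-suc zero    g = +-identityʳ (g 0)
sumBelow-suc (suc k) g = trans (cong (g 0 +_) (sumBelow-suc k (λ l → g (suc l)))) (sym (+-assoc (g 0) _ _))

module PathCounts {n : ℕ} (E : Graph n) (acyclic : Acyclic E) where

  IsPathCount : Fin n → (Fin n → ℕ) → Set
  IsPathCount x f = ∀ u → f u ≡ ⟦ u == x ⟧ + sumWhere (E u) f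

  walkSum : ℕ → (Fin n → ℕ) → Fin n → ℕ
  walkSum zero    f u = f u
  walkSum (suc k) f u = sumWhere (E u) (walkSum k f)

  walkSum-positive⇒walk : ∀ k f u → 0 < walkSum k f u → Walk {E = E} k u
  walkSum-positive⇒walk zero    f u _        = []
  walkSum-positive⇒walk (suc k) f u positive with sumWhere-positive (E u) (walkSum k f) positive
  ... | w , uw , positive′ = uw ∷ walkSum-positive⇒walk k f w positive′

  walkSum-vanishes : ∀ f u → walkSum n f u ≡ 0
  walkSum-vanishes f u with walkSum n f u in eq
  ... | zero  = refl
  ... | suc _ = ⊥-elim (acyclic⇒no-walk acyclic
                  (walkSum-positive⇒walk n f u (subst (0 <_) (sym eq) (s≤s z≤n))))

  walks≡walkSum : ∀ l u x → walks E l u x ≡ walkSum l (λ w → ⟦ w == x ⟧) u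
  walks≡walkSum zero    u x = refl
  walks≡walkSum (suc l) u x = sumF-cong (λ w → cong (⟦ E u w ⟧ *_) (walks≡walkSum l w x))

  sumWhere-walks : ∀ k u x → sumWhere (E u) (λ w → sumBelow k (λ l → walks E l w x))
                             ≡ sumBelow k (λ l → walks E (suc l) u x)
  sumWhere-walks k u x = begin
    sumF (λ w → ⟦ E u w ⟧ * sumF {k} (λ l → walks E (toℕ l) w x))
      ≡⟨ sumF-cong (λ w → sym (sumF-*ˡ {k} ⟦ E u w ⟧ (λ l → walks E (toℕ l) w x))) ⟩
    sumF (λ w → sumF {k} (λ l → ⟦ E u w ⟧ * walks E (toℕ l) w x))
      ≡⟨ sumF-comm {n} {k} (λ w l → ⟦ E u w ⟧ * walks E (toℕ l) w x) ⟩
    sumBelow k (λ l → walks E (suc l) u x) ∎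
    where open ≡-Reasoning

  -- Splitting walks at their first arc shifts lengths by one; the one extra
  -- length, n, contributes nothing by acyclicity.
  σ-recursion : ∀ u x → σ E u x ≡ ⟦ u == x ⟧ + sumWhere (E u) (λ w → σ E w x)
  σ-recursion u x = begin
    sumBelow n (λ l → walks E l u x)                        ≡⟨ sym (+-identityʳ _) ⟩
    sumBelow n (λ l → walks E l u x) + 0                    ≡⟨ cong (sumBelow n (λ l → walks E l u x) +_)
                                                                 (sym no-walks-of-length-n) ⟩
    sumBelow n (λ l → walks E l u x) + walks E n u x        ≡⟨ sym (sumBelow-suc n (λ l → walks E l u x)) ⟩
    ⟦ u == x ⟧ + sumBelow n (λ l → walks E (suc l) u x)     ≡⟨ cong (⟦ u == x ⟧ +_) (sym (sumWhere-walks n u x)) ⟩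
    ⟦ u == x ⟧ + sumWhere (E u) (λ w → σ E w x)             ∎
    where
      open ≡-Reasoning
      no-walks-of-length-n : walks E n u x ≡ 0
      no-walks-of-length-n = trans (walks≡walkSum n u x) (walkSum-vanishes _ u)

  isPathCount-unfold : ∀ {x f} → IsPathCount x f → ∀ k u →
                       f u ≡ sumBelow k (λ l → walks E l u x) + walkSum k f u
  isPathCount-unfold         solves zero    u = refl
  isPathCount-unfold {x} {f} solves (suc k) u = begin
    f u
      ≡⟨ solves u ⟩
    ⟦ u == x ⟧ + sumWhere (E u) f
      ≡⟨ cong (⟦ u == x ⟧ +_) (sumF-cong (λ w → cong (⟦ E u w ⟧ *_) (isPathCount-unfold solves k w))) ⟩
    ⟦ u == x ⟧ + sumF (λ w → ⟦ E u w ⟧ * (walksBelow k w + walkSum k f w))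
      ≡⟨ cong (⟦ u == x ⟧ +_) (trans (sumF-cong (λ w → *-distribˡ-+ ⟦ E u w ⟧ _ _))
                                      (sumF-+ (λ w → ⟦ E u w ⟧ * walksBelow k w) _)) ⟩
    ⟦ u == x ⟧ + (sumWhere (E u) (walksBelow k) + walkSum (suc k) f u)
      ≡⟨ cong (λ t → ⟦ u == x ⟧ + (t + walkSum (suc k) f u)) (sumWhere-walks k u x) ⟩
    ⟦ u == x ⟧ + (sumBelow k (λ l → walks E (suc l) u x) + walkSum (suc k) f u)
      ≡⟨ sym (+-assoc ⟦ u == x ⟧ _ _) ⟩
    walksBelow (suc k) u + walkSum (suc k) f u ∎
    where
      open ≡-Reasoning
      walksBelow : ℕ → Fin n → ℕ
      walksBelow k w = sumBelow k (λ l → walks E l w x)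

  isPathCount⇒σ : ∀ {x f} → IsPathCount x f → ∀ u → f u ≡ σ E u x
  isPathCount⇒σ solves u = trans (isPathCount-unfold solves n u)
    (trans (cong (sumBelow n (λ l → walks E l u _) +_) (walkSum-vanishes _ u)) (+-identityʳ _))

  σ-arc-≤ : ∀ {u w} x → Arc E u w → σ E w x ≤ σ E u x
  σ-arc-≤ {u} {w} x uw rewrite σ-recursion u x =
    ≤-trans (term≤sumWhere (E u) (λ w → σ E w x) w uw) (m≤n+m _ ⟦ u == x ⟧)

  σ-reach-≤ : ∀ {u v} x → Reach⁺ E u v → σ E v x ≤ σ E u x
  σ-reach-≤ x (one uv)    = σ-arc-≤ x uv
  σ-reach-≤ x (cons uw r) = ≤-trans (σ-reach-≤ x r) (σ-arc-≤ x uw)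

  1≤σ-self : ∀ x → 1 ≤ σ E x x
  1≤σ-self x rewrite σ-recursion x x | ==-refl x = s≤s z≤n

  reach⇒1≤σ : ∀ {u x} → Reach⁺ E u x → 1 ≤ σ E u x
  reach⇒1≤σ {x = x} r = ≤-trans (1≤σ-self x) (σ-reach-≤ x r)

  1≤σ⇒reach : ∀ {u x} → 1 ≤ σ E u x → u ≡ x ⊎ Reach⁺ E u x
  1≤σ⇒reach 1≤σ with reach-or-walk n 1≤σ
    where
      reach-or-walk : ∀ k {u x} → 1 ≤ σ E u x → (u ≡ x ⊎ Reach⁺ E u x) ⊎ Walk {E = E} k u
      reach-or-walk zero    _ = inj₂ []
      reach-or-walk (suc k) {u} {x} 1≤σ rewrite σ-recursion u x with u ≟ x
      ... | yes u≡x = inj₁ (inj₁ u≡x)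
      ... | no _ with sumWhere-positive (E u) (λ w → σ E w x) 1≤σ
      ...   | w , uw , 1≤σw with reach-or-walk k 1≤σw
      ...     | inj₁ (inj₁ refl) = inj₁ (inj₂ (one uw))
      ...     | inj₁ (inj₂ r)    = inj₁ (inj₂ (cons uw r))
      ...     | inj₂ W           = inj₂ (uw ∷ W)
  ... | inj₁ reached = reached
  ... | inj₂ W       = ⊥-elim (acyclic⇒no-walk acyclic W)

  leaf-below : ∀ u → Σ (Fin n) (λ x → IsLeaf E x × 1 ≤ σ E u x)
  leaf-below u with leaf-or-walk n u
    where
      leaf-or-walk : ∀ k u → Σ (Fin n) (λ x → IsLeaf E x × 1 ≤ σ E u x) ⊎ Walk {E = E} k u
      leaf-or-walk zero    u = inj₂ []
      leaf-or-walk (suc k) u with outdeg E u in out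
      ... | zero  = inj₁ (u , out , 1≤σ-self u)
      ... | suc _ with 1≤countF⇒true (E u) (subst (1 ≤_) (sym out) (s≤s z≤n))
      ...   | c , uc with leaf-or-walk k c
      ...     | inj₁ (x , leaf , 1≤σ) = inj₁ (x , leaf , ≤-trans 1≤σ (σ-arc-≤ x uc))
      ...     | inj₂ W                = inj₂ (uc ∷ W)
  ... | inj₁ found = found
  ... | inj₂ W     = ⊥-elim (acyclic⇒no-walk acyclic W)

  σ-no-parents : ∀ {u x} → (∀ v → E v x ≡ false) → u ≢ x → σ E u x ≡ 0
  σ-no-parents {u} {x} no-parents u≢x with σ E u x in eq
  ... | zero  = refl
  ... | suc _ with 1≤σ⇒reach {u} {x} (subst (1 ≤_) (sym eq) (s≤s z≤n))
  ...   | inj₁ u≡x = ⊥-elim (u≢x u≡x)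
  ...   | inj₂ r with reach-unsnoc r
  ...     | y , _ , yx = ⊥-elim (false≢true (trans (sym (no-parents y)) yx))

  σ-leaf : ∀ {u} x → outdeg E u ≡ 0 → σ E u x ≡ ⟦ u == x ⟧
  σ-leaf {u} x leaf rewrite σ-recursion u x
                          | sumWhere-none (E u) (λ w → σ E w x) (countF≡0⇒false (E u) leaf) = +-identityʳ _

  σ-only-child : ∀ {u c} x → Arc E u c → (∀ y → Arc E u y → y ≡ c) → u ≢ x → σ E u x ≡ σ E c x
  σ-only-child {u} {c} x uc only-c u≢x rewrite σ-recursion u x | ==-≢ u≢x =
    sumWhere-one (E u) (λ w → σ E w x) c uc only-c

  σ-two-children : ∀ {u c₁ c₂} x → c₁ ≢ c₂ → Arc E u c₁ → Arc E u c₂ →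
                   (∀ y → Arc E u y → y ≡ c₁ ⊎ y ≡ c₂) → u ≢ x → σ E u x ≡ σ E c₁ x + σ E c₂ x
  σ-two-children {u} {c₁} {c₂} x c₁≢c₂ uc₁ uc₂ only u≢x rewrite σ-recursion u x | ==-≢ u≢x =
    sumWhere-two (E u) (λ w → σ E w x) c₁ c₂ c₁≢c₂ uc₁ uc₂ only

  σ-two-children-≤ : ∀ {u c₁ c₂} x → c₁ ≢ c₂ → Arc E u c₁ → Arc E u c₂ →
                     σ E c₁ x + σ E c₂ x ≤ σ E u x
  σ-two-children-≤ {u} {c₁} {c₂} x c₁≢c₂ uc₁ uc₂ rewrite σ-recursion u x =
    ≤-trans (two-terms≤sumWhere (E u) (λ w → σ E w x) c₁ c₂ c₁≢c₂ uc₁ uc₂) (m≤n+m _ ⟦ u == x ⟧)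

  σ-via-only-parent : ∀ {P a} → Arc E P a → (∀ y → Arc E y a → y ≡ P) →
                      ∀ u → σ E u a ≡ σ E u P + ⟦ u == a ⟧
  σ-via-only-parent {P} {a} Pa only-P u = sym (isPathCount⇒σ solves u)
    where
      arc-to-a : ∀ u → sumWhere (E u) (λ v → ⟦ v == a ⟧) ≡ ⟦ u == P ⟧
      arc-to-a u = begin
        sumWhere (E u) (λ v → ⟦ v == a ⟧)  ≡⟨ sumF-support₁ a _ off-a ⟩
        ⟦ E u a ⟧ * ⟦ a == a ⟧             ≡⟨ cong (λ b → ⟦ E u a ⟧ * ⟦ b ⟧) (==-refl a) ⟩
        ⟦ E u a ⟧ * 1                      ≡⟨ *-identityʳ _ ⟩
        ⟦ E u a ⟧                          ≡⟨ cong ⟦_⟧ arc-iff-parent ⟩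
        ⟦ u == P ⟧                         ∎
        where
          open ≡-Reasoning
          off-a : ∀ v → v ≢ a → ⟦ E u v ⟧ * ⟦ v == a ⟧ ≡ 0
          off-a v v≢a rewrite ==-≢ v≢a = *-zeroʳ ⟦ E u v ⟧
          arc-iff-parent : E u a ≡ (u == P)
          arc-iff-parent with E u a in ua | u ≟ P
          ... | true  | yes _    = refl
          ... | true  | no u≢P   = ⊥-elim (u≢P (only-P u ua))
          ... | false | yes refl = ⊥-elim (false≢true (trans (sym ua) Pa))
          ... | false | no _     = refl
      rearrange : ∀ δP s δa → (δP + s) + δa ≡ δa + (s + δP)
      rearrange = solve-∀
      solves : IsPathCount a (λ u → σ E u P + ⟦ u == a ⟧)
      solves u = begin
        σ E u P + ⟦ u == a ⟧
          ≡⟨ cong (_+ ⟦ u == a ⟧) (σ-recursion u P) ⟩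
        (⟦ u == P ⟧ + sumWhere (E u) (λ v → σ E v P)) + ⟦ u == a ⟧
          ≡⟨ rearrange ⟦ u == P ⟧ _ ⟦ u == a ⟧ ⟩
        ⟦ u == a ⟧ + (sumWhere (E u) (λ v → σ E v P) + ⟦ u == P ⟧)
          ≡⟨ cong (λ t → ⟦ u == a ⟧ + (sumWhere (E u) (λ v → σ E v P) + t)) (sym (arc-to-a u)) ⟩
        ⟦ u == a ⟧ + (sumWhere (E u) (λ v → σ E v P) + sumWhere (E u) (λ v → ⟦ v == a ⟧))
          ≡⟨ cong (⟦ u == a ⟧ +_) (sym (sumF-+ (λ v → ⟦ E u v ⟧ * σ E v P) (λ v → ⟦ E u v ⟧ * ⟦ v == a ⟧))) ⟩
        ⟦ u == a ⟧ + sumF (λ v → ⟦ E u v ⟧ * σ E v P + ⟦ E u v ⟧ * ⟦ v == a ⟧)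
          ≡⟨ cong (⟦ u == a ⟧ +_) (sumF-cong (λ v → sym (*-distribˡ-+ ⟦ E u v ⟧ (σ E v P) ⟦ v == a ⟧))) ⟩
        ⟦ u == a ⟧ + sumWhere (E u) (λ v → σ E v P + ⟦ v == a ⟧) ∎
        where open ≡-Reasoning

  -- Every child of w reaches b: the leaves below w are a or b, and a path to a
  -- passes through P. Hence σ(w, b) ≥ 2, whereas σ(P, b) ≤ 1.
  bounded-top-unclonable : ∀ {P a b w} → a ≢ b → IsLeaf E a → IsLeaf E b →
    (∀ y → Arc E y a → y ≡ P) → Reach⁺ E P b →
    (∀ x → IsLeaf E x → σ E P x ≤ ⟦ x == a ⟧ + ⟦ x == b ⟧) →
    w ≢ P → 2 ≤ outdeg E w → ¬ Clones E P w
  bounded-top-unclonable {P} {a} {b} {w} a≢b leaf-a leaf-b parent-a P↝b bound w≢P 2≤out clones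
    with 2≤countF⇒two-true (E w) 2≤out
  ... | c₁ , c₂ , c₁≢c₂ , wc₁ , wc₂ = 1+n≰n (begin
    2                      ≤⟨ +-mono-≤ (child-reaches-b wc₁) (child-reaches-b wc₂) ⟩
    σ E c₁ b + σ E c₂ b    ≤⟨ σ-two-children-≤ b c₁≢c₂ wc₁ wc₂ ⟩
    σ E w b                ≡⟨ sym (clones b leaf-b) ⟩
    σ E P b                ≤⟨ bound b leaf-b ⟩
    ⟦ b == a ⟧ + ⟦ b == b ⟧ ≡⟨ cong₂ _+_ (cong ⟦_⟧ (==-≢ (≢-sym a≢b))) (cong ⟦_⟧ (==-refl b)) ⟩
    1                      ∎)
    where
      open ≤-Reasoning
      child-reaches-b : ∀ {c} → Arc E w c → 1 ≤ σ E c b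
      child-reaches-b {c} wc with leaf-below c
      ... | y , leaf-y , 1≤σ with y ≟ b | y ≟ a
      ...   | yes refl | _     = 1≤σ
      ...   | no y≢b  | no y≢a = ⊥-elim (1+n≰n (begin
        1                         ≤⟨ ≤-trans 1≤σ (σ-arc-≤ y wc) ⟩
        σ E w y                   ≡⟨ sym (clones y leaf-y) ⟩
        σ E P y                   ≤⟨ bound y leaf-y ⟩
        ⟦ y == a ⟧ + ⟦ y == b ⟧   ≡⟨ cong₂ _+_ (cong ⟦_⟧ (==-≢ y≢a)) (cong ⟦_⟧ (==-≢ y≢b)) ⟩
        0                         ∎))
      ...   | no _    | yes refl with 1≤σ⇒reach 1≤σ
      ...     | inj₁ refl = ⊥-elim (w≢P (parent-a w wc))
      ...     | inj₂ c↝a with reach-unsnoc c↝a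
      ...       | y′ , inj₁ refl , y′a rewrite parent-a y′ y′a = reach⇒1≤σ P↝b
      ...       | y′ , inj₂ c↝y′ , y′a rewrite parent-a y′ y′a = reach⇒1≤σ (reach-trans c↝y′ P↝b)

deleteVertex : ∀ {n} → Fin n → Graph n → Graph n
deleteVertex z A u v = A u v ∧ not (u == z) ∧ not (v == z)

deleteArc : ∀ {n} → Fin n → Fin n → Graph n → Graph n
deleteArc p q A u v = A u v ∧ not ((u == p) ∧ (v == q))

addArc : ∀ {n} → Fin n → Fin n → Graph n → Graph n
addArc p c A u v = A u v ∨ ((u == p) ∧ (v == c))

reach-map : ∀ {n} {A B : Graph n} → (∀ {u v} → Arc B u v → Reach⁺ A u v) → ∀ {u v} → Reach⁺ B u v → Reach⁺ A u v
reach-map embed (one uv)    = embed uv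
reach-map embed (cons uw r) = reach-trans (embed uw) (reach-map embed r)

acyclic-by-reach : ∀ {n} {A B : Graph n} → (∀ {u v} → Arc B u v → Reach⁺ A u v) → Acyclic A → Acyclic B
acyclic-by-reach embed acyclic u cycle = acyclic u (reach-map embed cycle)

clones-transfer : ∀ {n} {A B : Graph n} (z : Fin n) →
  (∀ x → x ≢ z → ∀ u → u ≢ z → σ B u x ≡ σ A u x) → (∀ u → u ≢ z → σ B u z ≡ 0) →
  (∀ x → x ≢ z → IsLeaf B x → IsLeaf A x) →
  ∀ {u w} → u ≢ z → w ≢ z → Clones A u w → Clones B u w
clones-transfer z σ-kept σ-at-z leaf-kept u≢z w≢z clones x leaf = case-≟ x z
  (λ { refl → trans (σ-at-z _ u≢z) (sym (σ-at-z _ w≢z)) })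
  (λ x≢z → trans (σ-kept x x≢z _ u≢z)
             (trans (clones x (leaf-kept x x≢z leaf)) (sym (σ-kept x x≢z _ w≢z))))

σ-transfer : ∀ {n} {A B : Graph n} → Acyclic A → Acyclic B → ∀ z {x} → x ≢ z →
  (∀ v → B z v ≡ false) →
  (∀ u → u ≢ z → sumWhere (B u) (erase z (λ v → σ A v x)) ≡ sumWhere (A u) (λ v → σ A v x)) →
  ∀ u → u ≢ z → σ B u x ≡ σ A u x
σ-transfer {n} {A} {B} acyclic-A acyclic-B z {x} x≢z from-z same-sums u u≢z =
  trans (sym (PathCounts.isPathCount⇒σ B acyclic-B solves u)) (erase-≢ σ-A u≢z)
  where
    σ-A : Fin n → ℕ
    σ-A v = σ A v x
    solves : PathCounts.IsPathCount B acyclic-B x (erase z σ-A)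
    solves u = case-≟ u z
      (λ { refl → trans (erase-self z σ-A)
                   (sym (cong₂ _+_ (cong ⟦_⟧ (==-≢ (≢-sym x≢z))) (sumWhere-none (B z) (erase z σ-A) from-z))) })
      (λ u≢z → begin
        erase z σ-A u                          ≡⟨ erase-≢ σ-A u≢z ⟩
        σ A u x                                ≡⟨ PathCounts.σ-recursion A acyclic-A u x ⟩
        ⟦ u == x ⟧ + sumWhere (A u) σ-A        ≡⟨ cong (⟦ u == x ⟧ +_) (sym (same-sums u u≢z)) ⟩
        ⟦ u == x ⟧ + sumWhere (B u) (erase z σ-A) ∎)
      where open ≡-Reasoning

module VertexDeletion {n : ℕ} (A : Graph n) (acyclic : Acyclic A) (z : Fin n)
  (z-extremal : (∀ v → A z v ≡ false) ⊎ (∀ u → A u z ≡ false)) where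

  D : Graph n
  D = deleteVertex z A

  D≡A : ∀ u v → u ≢ z → v ≢ z → D u v ≡ A u v
  D≡A u v u≢z v≢z rewrite ==-≢ u≢z | ==-≢ v≢z = ∧-identityʳ (A u v)

  D-from-z : ∀ v → D z v ≡ false
  D-from-z v rewrite ==-refl z = ∧-zeroʳ (A z v)

  D-into-z : ∀ u → D u z ≡ false
  D-into-z u rewrite ==-refl z = trans (cong (A u z ∧_) (∧-zeroʳ _)) (∧-zeroʳ (A u z))

  D⊆A : ∀ {u v} → Arc D u v → Arc A u v
  D⊆A uv = ∧-conicalˡ _ _ uv

  arc-D⇒≢z : ∀ {u v} → Arc D u v → u ≢ z × v ≢ z
  arc-D⇒≢z {u} {v} uv = (λ { refl → false≢true (trans (sym (D-from-z v)) uv) })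
                      , (λ { refl → false≢true (trans (sym (D-into-z u)) uv) })

  acyclic-D : Acyclic D
  acyclic-D = acyclic-by-reach (λ uv → one (D⊆A uv)) acyclic

  outdeg-D : ∀ v → v ≢ z → outdeg D v + ⟦ A v z ⟧ ≡ outdeg A v
  outdeg-D v v≢z = trans (countF-exchange₁ (D v) (A v) z (λ y y≢z → D≡A v y v≢z y≢z))
                         (trans (cong (λ b → outdeg A v + ⟦ b ⟧) (D-into-z v)) (+-identityʳ _))

  indeg-D : ∀ v → v ≢ z → indeg D v + ⟦ A z v ⟧ ≡ indeg A v
  indeg-D v v≢z = trans (countF-exchange₁ (λ y → D y v) (λ y → A y v) z (λ y y≢z → D≡A y v y≢z v≢z))
                        (trans (cong (λ b → indeg A v + ⟦ b ⟧) (D-from-z v)) (+-identityʳ _))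

  outdeg-D-kept : ∀ {v} → v ≢ z → A v z ≡ false → outdeg D v ≡ outdeg A v
  outdeg-D-kept {v} v≢z no-arc =
    trans (sym (+-identityʳ _)) (trans (cong (λ b → outdeg D v + ⟦ b ⟧) (sym no-arc)) (outdeg-D v v≢z))

  indeg-D-kept : ∀ {v} → v ≢ z → A z v ≡ false → indeg D v ≡ indeg A v
  indeg-D-kept {v} v≢z no-arc =
    trans (sym (+-identityʳ _)) (trans (cong (λ b → indeg D v + ⟦ b ⟧) (sym no-arc)) (indeg-D v v≢z))

  module σA = PathCounts A acyclic
  module σD = PathCounts D acyclic-D

  σ-D : ∀ x → x ≢ z → ∀ u → u ≢ z → σ D u x ≡ σ A u x
  σ-D x x≢z = σ-transfer acyclic acyclic-D z x≢z D-from-z same-sums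
    where
      no-flow-through-z : ∀ u → ⟦ A u z ⟧ * σ A z x ≡ 0
      no-flow-through-z u = [ no-descendants , no-parents ]′ z-extremal
        where
          no-descendants : (∀ v → A z v ≡ false) → ⟦ A u z ⟧ * σ A z x ≡ 0
          no-descendants no-out rewrite σA.σ-leaf x (all-false⇒countF≡0 (A z) no-out)
                                      | ==-≢ (≢-sym x≢z) = *-zeroʳ ⟦ A u z ⟧
          no-parents : (∀ u → A u z ≡ false) → ⟦ A u z ⟧ * σ A z x ≡ 0
          no-parents no-in rewrite no-in u = refl
      same-sums : ∀ u → u ≢ z → sumWhere (D u) (erase z (λ v → σ A v x)) ≡ sumWhere (A u) (λ v → σ A v x)
      same-sums u u≢z = sumF-cong λ v → case-≟ v z
        (λ { refl → trans (cong (⟦ D u z ⟧ *_) (erase-self z (λ v → σ A v x)))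
                          (trans (*-zeroʳ ⟦ D u z ⟧) (sym (no-flow-through-z u))) })
        (λ v≢z → cong₂ _*_ (cong ⟦_⟧ (D≡A u v u≢z v≢z)) (erase-≢ (λ v → σ A v x) v≢z))

  σ-D-into-z : ∀ u → u ≢ z → σ D u z ≡ 0
  σ-D-into-z u u≢z = σD.σ-no-parents D-into-z u≢z

module ArcDeletion {n : ℕ} (A : Graph n) (acyclic : Acyclic A) (p q : Fin n) (pq : Arc A p q) where

  D : Graph n
  D = deleteArc p q A

  D≡A : ∀ u v → ¬ (u ≡ p × v ≡ q) → D u v ≡ A u v
  D≡A u v not-pq with u ≟ p | v ≟ q
  ... | yes refl | yes refl = ⊥-elim (not-pq (refl , refl))
  ... | no _     | _        = ∧-identityʳ (A u v)
  ... | yes refl | no _     = ∧-identityʳ (A u v)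

  D-cut : D p q ≡ false
  D-cut rewrite ==-refl p | ==-refl q = ∧-zeroʳ (A p q)

  D⊆A : ∀ {u v} → Arc D u v → Arc A u v
  D⊆A uv = ∧-conicalˡ _ _ uv

  acyclic-D : Acyclic D
  acyclic-D = acyclic-by-reach (λ uv → one (D⊆A uv)) acyclic

  outdeg-D : ∀ v → v ≢ p → outdeg D v ≡ outdeg A v
  outdeg-D v v≢p = countF-cong (D v) (A v) (λ y → D≡A v y (λ e → v≢p (proj₁ e)))

  indeg-D : ∀ v → v ≢ q → indeg D v ≡ indeg A v
  indeg-D v v≢q = countF-cong (λ y → D y v) (λ y → A y v) (λ y → D≡A y v (λ e → v≢q (proj₂ e)))

  outdeg-D-p : outdeg D p + 1 ≡ outdeg A p
  outdeg-D-p = begin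
    outdeg D p + 1            ≡⟨ cong (λ b → outdeg D p + ⟦ b ⟧) (sym pq) ⟩
    outdeg D p + ⟦ A p q ⟧    ≡⟨ countF-exchange₁ (D p) (A p) q (λ y y≢q → D≡A p y (λ e → y≢q (proj₂ e))) ⟩
    outdeg A p + ⟦ D p q ⟧    ≡⟨ cong (λ b → outdeg A p + ⟦ b ⟧) D-cut ⟩
    outdeg A p + 0            ≡⟨ +-identityʳ _ ⟩
    outdeg A p                ∎
    where open ≡-Reasoning

  indeg-D-q : indeg D q + 1 ≡ indeg A q
  indeg-D-q = begin
    indeg D q + 1             ≡⟨ cong (λ b → indeg D q + ⟦ b ⟧) (sym pq) ⟩
    indeg D q + ⟦ A p q ⟧     ≡⟨ countF-exchange₁ (λ y → D y q) (λ y → A y q) p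
                                   (λ y y≢p → D≡A y q (λ e → y≢p (proj₁ e))) ⟩
    indeg A q + ⟦ D p q ⟧     ≡⟨ cong (λ b → indeg A q + ⟦ b ⟧) D-cut ⟩
    indeg A q + 0             ≡⟨ +-identityʳ _ ⟩
    indeg A q                 ∎
    where open ≡-Reasoning

  module σA = PathCounts A acyclic
  module σD = PathCounts D acyclic-D

  σ-D-q-p≡0 : σ D q p ≡ 0
  σ-D-q-p≡0 with σ D q p in eq
  ... | zero  = refl
  ... | suc _ with σD.1≤σ⇒reach {q} {p} (subst (1 ≤_) (sym eq) (s≤s z≤n))
  ...   | inj₁ q≡p = ⊥-elim (arc-irreflexive acyclic pq (sym q≡p))
  ...   | inj₂ q↝p = ⊥-elim (acyclic p (cons pq (reach-map (λ uv → one (D⊆A uv)) q↝p)))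

  sumWhere-A : ∀ u h → sumWhere (A u) h ≡ sumWhere (D u) h + ⟦ u == p ⟧ * h q
  sumWhere-A u h = case-≟ u p
    (λ { refl → begin
      sumWhere (A u) h                        ≡⟨ sym (+-identityʳ _) ⟩
      sumWhere (A u) h + 0                    ≡⟨ cong (λ b → sumWhere (A u) h + ⟦ b ⟧ * h q) (sym D-cut) ⟩
      sumWhere (A u) h + ⟦ D u q ⟧ * h q      ≡⟨ sym (sumF-exchange q _ _ (λ y y≢q →
                                                    cong (λ b → ⟦ b ⟧ * h y) (D≡A u y (λ e → y≢q (proj₂ e))))) ⟩
      sumWhere (D u) h + ⟦ A u q ⟧ * h q      ≡⟨ cong (λ b → sumWhere (D u) h + ⟦ b ⟧ * h q)
                                                     (trans pq (sym (==-refl u))) ⟩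
      sumWhere (D u) h + ⟦ u == u ⟧ * h q     ∎ })
    (λ u≢p → begin
      sumWhere (A u) h                        ≡⟨ sumF-cong (λ y → cong (λ b → ⟦ b ⟧ * h y)
                                                    (sym (D≡A u y (λ e → u≢p (proj₁ e))))) ⟩
      sumWhere (D u) h                        ≡⟨ sym (+-identityʳ _) ⟩
      sumWhere (D u) h + 0                    ≡⟨ cong (λ b → sumWhere (D u) h + ⟦ b ⟧ * h q) (sym (==-≢ u≢p)) ⟩
      sumWhere (D u) h + ⟦ u == p ⟧ * h q     ∎)
    where open ≡-Reasoning

  -- A path in A either avoids the arc (p, q), or uses it exactly once.
  σ-split : ∀ x u → σ A u x ≡ σ D u x + σ D u p * σ D q x
  σ-split x u = sym (σA.isPathCount⇒σ solves u)
    where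
      K : ℕ
      K = σ D q x
      g : Fin n → ℕ
      g u = σ D u x + σ D u p * K
      g-q : g q ≡ K
      g-q rewrite σ-D-q-p≡0 = +-identityʳ K
      sumWhere-D-g : ∀ u → sumWhere (D u) g ≡ sumWhere (D u) (λ v → σ D v x) + sumWhere (D u) (λ v → σ D v p) * K
      sumWhere-D-g u = begin
        sumF (λ v → ⟦ D u v ⟧ * (σ D v x + σ D v p * K))
          ≡⟨ sumF-cong (λ v → distribute ⟦ D u v ⟧ (σ D v x) (σ D v p) K) ⟩
        sumF (λ v → ⟦ D u v ⟧ * σ D v x + ⟦ D u v ⟧ * σ D v p * K)
          ≡⟨ sumF-+ (λ v → ⟦ D u v ⟧ * σ D v x) (λ v → ⟦ D u v ⟧ * σ D v p * K) ⟩
        sumWhere (D u) (λ v → σ D v x) + sumF (λ v → ⟦ D u v ⟧ * σ D v p * K)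
          ≡⟨ cong (sumWhere (D u) (λ v → σ D v x) +_) (sumF-*ʳ (λ v → ⟦ D u v ⟧ * σ D v p) K) ⟩
        sumWhere (D u) (λ v → σ D v x) + sumWhere (D u) (λ v → σ D v p) * K ∎
        where
          open ≡-Reasoning
          distribute : ∀ b s t k → b * (s + t * k) ≡ b * s + b * t * k
          distribute = solve-∀
      rearrange : ∀ δx s δp t k → (δx + s) + (δp + t) * k ≡ δx + ((s + t * k) + δp * k)
      rearrange = solve-∀
      solves : σA.IsPathCount x g
      solves u = begin
        σ D u x + σ D u p * K
          ≡⟨ cong₂ (λ s t → s + t * K) (σD.σ-recursion u x) (σD.σ-recursion u p) ⟩
        (⟦ u == x ⟧ + sumWhere (D u) (λ v → σ D v x)) + (⟦ u == p ⟧ + sumWhere (D u) (λ v → σ D v p)) * K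
          ≡⟨ rearrange ⟦ u == x ⟧ _ ⟦ u == p ⟧ _ K ⟩
        ⟦ u == x ⟧ + ((sumWhere (D u) (λ v → σ D v x) + sumWhere (D u) (λ v → σ D v p) * K) + ⟦ u == p ⟧ * K)
          ≡⟨ cong (λ t → ⟦ u == x ⟧ + t) (cong₂ _+_ (sym (sumWhere-D-g u)) (cong (⟦ u == p ⟧ *_) (sym g-q))) ⟩
        ⟦ u == x ⟧ + (sumWhere (D u) g + ⟦ u == p ⟧ * g q)
          ≡⟨ cong (⟦ u == x ⟧ +_) (sym (sumWhere-A u g)) ⟩
        ⟦ u == x ⟧ + sumWhere (A u) g ∎
        where open ≡-Reasoning

module Suppression {n : ℕ} (A : Graph n) (acyclic : Acyclic A) {w p c : Fin n}
  (pw : Arc A p w) (wc : Arc A w c)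
  (parent-w : ∀ y → Arc A y w → y ≡ p) (child-w : ∀ y → Arc A w y → y ≡ c)
  (parent-c : ∀ y → Arc A y c → y ≡ w) where

  B : Graph n
  B = addArc p c (deleteVertex w A)

  p≢w : p ≢ w
  p≢w = arc-irreflexive acyclic pw

  w≢c : w ≢ c
  w≢c = arc-irreflexive acyclic wc

  no-arc-pc : A p c ≡ false
  no-arc-pc with A p c in pc
  ... | false = refl
  ... | true  = ⊥-elim (p≢w (parent-c p pc))

  B≡A : ∀ u v → u ≢ w → v ≢ w → ¬ (u ≡ p × v ≡ c) → B u v ≡ A u v
  B≡A u v u≢w v≢w not-pc rewrite ==-≢ u≢w | ==-≢ v≢w with u ≟ p | v ≟ c
  ... | yes u≡p | yes v≡c = ⊥-elim (not-pc (u≡p , v≡c))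
  ... | no _    | _       = trans (cong (_∨ false) (∧-identityʳ (A u v))) (∨-identityʳ (A u v))
  ... | yes _   | no _    = trans (cong (_∨ false) (∧-identityʳ (A u v))) (∨-identityʳ (A u v))

  B-from-w : ∀ v → B w v ≡ false
  B-from-w v rewrite ==-refl w | ==-≢ (≢-sym p≢w) = trans (∨-identityʳ _) (∧-zeroʳ (A w v))

  B-into-w : ∀ u → B u w ≡ false
  B-into-w u rewrite ==-refl w | ==-≢ w≢c | ∧-zeroʳ (u == p) | ∧-zeroʳ (not (u == w)) =
    trans (∨-identityʳ _) (∧-zeroʳ (A u w))

  B-pc : B p c ≡ true
  B-pc rewrite ==-refl p | ==-refl c = ∨-zeroʳ _

  A⊆B : ∀ {u v} → Arc A u v → u ≢ w → v ≢ w → Arc B u v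
  A⊆B {u} {v} uv u≢w v≢w rewrite ==-≢ u≢w | ==-≢ v≢w | uv = refl

  B-cases : ∀ {u v} → Arc B u v → Arc A u v ⊎ (u ≡ p × v ≡ c)
  B-cases {u} {v} uv with A u v in eq | u ≟ p | v ≟ c
  ... | true  | _        | _        = inj₁ refl
  ... | false | yes u≡p  | yes v≡c  = inj₂ (u≡p , v≡c)
  ... | false | no _     | _        = ⊥-elim (false≢true uv)
  ... | false | yes _    | no _     = ⊥-elim (false≢true uv)

  acyclic-B : Acyclic B
  acyclic-B = acyclic-by-reach embed acyclic
    where
      embed : ∀ {u v} → Arc B u v → Reach⁺ A u v
      embed uv with B-cases uv
      ... | inj₁ uv′          = one uv′
      ... | inj₂ (refl , refl) = cons pw (one wc)

  B≡A-row : ∀ u → u ≢ w → u ≢ p → ∀ v → B u v ≡ A u v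
  B≡A-row u u≢w u≢p v = case-≟ v w
    (λ { refl → trans (B-into-w u) (sym (not-parent-of-w)) })
    (λ v≢w → B≡A u v u≢w v≢w (λ e → u≢p (proj₁ e)))
    where
      not-parent-of-w : A u w ≡ false
      not-parent-of-w with A u w in uw
      ... | false = refl
      ... | true  = ⊥-elim (u≢p (parent-w u uw))

  B≡A-column : ∀ v → v ≢ w → v ≢ c → ∀ u → B u v ≡ A u v
  B≡A-column v v≢w v≢c u = case-≟ u w
    (λ { refl → trans (B-from-w v) (sym not-child-of-w) })
    (λ u≢w → B≡A u v u≢w v≢w (λ e → v≢c (proj₂ e)))
    where
      not-child-of-w : A w v ≡ false
      not-child-of-w with A w v in wv
      ... | false = refl
      ... | true  = ⊥-elim (v≢c (child-w v wv))

  -- p trades its child w for c, and c trades its parent w for p.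
  outdeg-B : ∀ v → v ≢ w → outdeg B v ≡ outdeg A v
  outdeg-B v v≢w = case-≟ v p
    (λ { refl → sym (countF-exchange₂ w c (A v) (B v) w≢c pw (B-into-w v) no-arc-pc B-pc
                   (λ y y≢w y≢c → sym (B≡A v y v≢w y≢w (λ e → y≢c (proj₂ e))))) })
    (λ v≢p → countF-cong (B v) (A v) (B≡A-row v v≢w v≢p))

  indeg-B : ∀ v → v ≢ w → indeg B v ≡ indeg A v
  indeg-B v v≢w = case-≟ v c
    (λ { refl → sym (countF-exchange₂ w p (λ y → A y v) (λ y → B y v) (≢-sym p≢w) wc (B-from-w v) no-arc-pc B-pc
                   (λ y y≢w y≢p → sym (B≡A y v y≢w v≢w (λ e → y≢p (proj₁ e))))) })
    (λ v≢c → countF-cong (λ y → B y v) (λ y → A y v) (B≡A-column v v≢w v≢c))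

  module σA = PathCounts A acyclic
  module σB = PathCounts B acyclic-B

  σ-B : ∀ x → x ≢ w → ∀ u → u ≢ w → σ B u x ≡ σ A u x
  σ-B x x≢w = σ-transfer acyclic acyclic-B w x≢w B-from-w same-sums
    where
      σ-A : Fin n → ℕ
      σ-A v = σ A v x
      f : Fin n → ℕ
      f = erase w σ-A
      term-w : ∀ u → ⟦ B u w ⟧ * f w ≡ 0
      term-w u = trans (cong (⟦ B u w ⟧ *_) (erase-self w σ-A)) (*-zeroʳ ⟦ B u w ⟧)
      same-sums : ∀ u → u ≢ w → sumWhere (B u) f ≡ sumWhere (A u) σ-A
      same-sums u u≢w = case-≟ u p
        (λ { refl → sumF-agree-off₂ w c _ _ w≢c
                      (λ y y≢w y≢c → cong₂ _*_ (cong ⟦_⟧ (B≡A u y u≢w y≢w (λ e → y≢c (proj₂ e))))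
                                                (erase-≢ σ-A y≢w))
                      (begin
            ⟦ B u w ⟧ * f w + ⟦ B u c ⟧ * f c   ≡⟨ cong₂ _+_ (term-w u)
                                                     (cong₂ _*_ (cong ⟦_⟧ B-pc) (erase-≢ σ-A (≢-sym w≢c))) ⟩
            0 + (σ A c x + 0)                   ≡⟨ +-identityʳ _ ⟩
            σ A c x                             ≡⟨ sym (σA.σ-only-child x wc child-w (≢-sym x≢w)) ⟩
            σ A w x                             ≡⟨ sym (+-identityʳ _) ⟩
            σ A w x + 0                         ≡⟨ sym (cong₂ _+_ (⟦true⟧* (σ A w x) pw)
                                                                  (cong (λ b → ⟦ b ⟧ * σ A c x) no-arc-pc)) ⟩
            ⟦ A u w ⟧ * σ A w x + ⟦ A u c ⟧ * σ A c x ∎) })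
        (λ u≢p → sumF-cong λ v → case-≟ v w
          (λ { refl → trans (term-w u)
                            (cong (λ b → ⟦ b ⟧ * σ A v x) (sym (trans (sym (B≡A-row u u≢w u≢p v)) (B-into-w u)))) })
          (λ v≢w → cong₂ _*_ (cong ⟦_⟧ (B≡A-row u u≢w u≢p v)) (erase-≢ σ-A v≢w)))
        where open ≡-Reasoning

  σ-B-into-w : ∀ u → u ≢ w → σ B u w ≡ 0
  σ-B-into-w u u≢w = σB.σ-no-parents B-into-w u≢w

-- In-degree 0 allows out-degree at most 2: this covers the root, deleted
-- (isolated) vertices, and a root that has lost a child to a cut.
DegreeKind : ℕ → ℕ → Set
DegreeKind i o = (i ≡ 1 × o ≡ 0) ⊎ (i ≡ 0 × o ≤ 2) ⊎ (i ≡ 1 × o ≡ 2) ⊎ (2 ≤ i × o ≡ 1)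

Kind : ∀ {n} → Graph n → Fin n → Set
Kind A v = DegreeKind (indeg A v) (outdeg A v)

-- The only in-degree 1, out-degree 1 vertices a reduction creates are parents of a leaf.
PendantParent : ∀ {n} → Graph n → Fin n → Set
PendantParent A v = indeg A v ≡ 1 × outdeg A v ≡ 1 ×
  Σ _ (λ c → Arc A v c × outdeg A c ≡ 0 × indeg A c ≡ 1)

KindOrPendant : ∀ {n} → Graph n → Fin n → Set
KindOrPendant A v = Kind A v ⊎ PendantParent A v

record Shaped {n} (Local : Graph n → Fin n → Set) (s : St n) : Set where
  field
    acyclic    : Acyclic (arc s)
    arcs-alive : ∀ {u v} → Arc (arc s) u v → Alive s u × Alive s v
    local      : ∀ v → Alive s v → Local (arc s) v

NetworkState : ∀ {n} → St n → Set
NetworkState = Shaped Kind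

NoClonedBranching : ∀ {n} → Graph n → Set
NoClonedBranching A = ∀ u w → u ≢ w → 2 ≤ outdeg A u → 2 ≤ outdeg A w → ¬ Clones A u w

DegreeKind-cong : ∀ {n} {A B : Graph n} {v} → indeg B v ≡ indeg A v → outdeg B v ≡ outdeg A v →
                  Kind A v → Kind B v
DegreeKind-cong in-eq out-eq = subst₂ DegreeKind (sym in-eq) (sym out-eq)

¬DegreeKind-1-1 : ¬ DegreeKind 1 1
¬DegreeKind-1-1 (inj₁ (_ , ()))
¬DegreeKind-1-1 (inj₂ (inj₁ (() , _)))
¬DegreeKind-1-1 (inj₂ (inj₂ (inj₁ (_ , ()))))
¬DegreeKind-1-1 (inj₂ (inj₂ (inj₂ (s≤s () , _))))

branching-kind : ∀ {i o} → DegreeKind i o → 2 ≤ o → (i ≡ 0 ⊎ i ≡ 1) × o ≡ 2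
branching-kind (inj₂ (inj₁ (i≡0 , o≤2)))       2≤o = inj₁ i≡0 , ≤-antisym o≤2 2≤o
branching-kind (inj₂ (inj₂ (inj₁ (i≡1 , o≡2)))) 2≤o = inj₂ i≡1 , o≡2
branching-kind (inj₁ (_ , refl))                ()
branching-kind (inj₂ (inj₂ (inj₂ (_ , refl))))  (s≤s ())

reticulation-kind : ∀ {i o} → DegreeKind i o → 2 ≤ i → o ≡ 1
reticulation-kind (inj₂ (inj₂ (inj₂ (_ , o≡1)))) _ = o≡1
reticulation-kind (inj₁ (refl , _))               (s≤s ())
reticulation-kind (inj₂ (inj₁ (refl , _)))        ()
reticulation-kind (inj₂ (inj₂ (inj₁ (refl , _)))) (s≤s ())

leaf-kind : ∀ {i o} → DegreeKind i o → o ≡ 0 → 1 ≤ i → i ≡ 1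
leaf-kind (inj₁ (i≡1 , _))              _    _   = i≡1
leaf-kind (inj₂ (inj₁ (refl , _)))      _    ()
leaf-kind (inj₂ (inj₂ (inj₁ (_ , refl)))) ()
leaf-kind (inj₂ (inj₂ (inj₂ (_ , refl)))) ()

2≤outdeg⇒¬leaf : ∀ {n} {A : Graph n} {x} → 2 ≤ outdeg A x → ¬ IsLeaf A x
2≤outdeg⇒¬leaf 2≤out leaf rewrite leaf with 2≤out
... | ()

2≤outdeg⇒arc : ∀ {n} {A : Graph n} {u} → 2 ≤ outdeg A u → Σ _ (Arc A u)
2≤outdeg⇒arc {A = A} {u} 2≤out = 1≤countF⇒true (A u) (≤-trans (s≤s z≤n) 2≤out)

no-cloned-branching-reflect : ∀ {n} {A B : Graph n} (P : Fin n) →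
  (∀ w → w ≢ P → 2 ≤ outdeg A w → ¬ Clones A P w) →
  (∀ u → u ≢ P → 2 ≤ outdeg A u → outdeg B u ≡ outdeg A u) →
  (∀ {u w} → u ≢ P → w ≢ P → 2 ≤ outdeg A u → 2 ≤ outdeg A w → Clones A u w → Clones B u w) →
  NoClonedBranching B → NoClonedBranching A
no-cloned-branching-reflect {A = A} {B} P P-unclonable outdeg-kept clones-kept no-clones-B u w u≢w 2≤u 2≤w clones =
  case-≟ u P (λ { refl → P-unclonable w (≢-sym u≢w) 2≤w clones }) λ u≢P →
  case-≟ w P (λ { refl → P-unclonable u u≢P 2≤u (λ x leaf → sym (clones x leaf)) }) λ w≢P →
  no-clones-B u w u≢w (kept u≢P 2≤u) (kept w≢P 2≤w) (clones-kept u≢P w≢P 2≤u 2≤w clones)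
  where
    kept : ∀ {v} → v ≢ P → 2 ≤ outdeg A v → 2 ≤ outdeg B v
    kept {v} v≢P 2≤v = subst (2 ≤_) (sym (outdeg-kept v v≢P 2≤v)) 2≤v

module _ {n : ℕ} (s : St n) {z : Fin n} where

  alive-delV : ∀ {v} → Alive (delV z s) v → v ≢ z × Alive s v
  alive-delV {v} alive with v ≟ z
  ... | yes _   = ⊥-elim (false≢true alive)
  ... | no v≢z = v≢z , alive

  delV-alive : ∀ {v} → v ≢ z → Alive s v → Alive (delV z s) v
  delV-alive {v} v≢z alive rewrite ==-≢ v≢z = alive

record SuppressionResult {n} (s s′ : St n) : Set where
  field
    network     : NetworkState s′
    outdeg-kept : ∀ v → 2 ≤ outdeg (arc s) v → outdeg (arc s′) v ≡ outdeg (arc s) v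
    clones-kept : ∀ {u w} → 2 ≤ outdeg (arc s) u → 2 ≤ outdeg (arc s) w →
                  Clones (arc s) u w → Clones (arc s′) u w

module SuppressionStep {n : ℕ} {s : St n} (shaped : Shaped KindOrPendant s) {w p c : Fin n}
  (alive-w : Alive s w) (in-1 : indeg (arc s) w ≡ 1) (out-1 : outdeg (arc s) w ≡ 1)
  (pw : Arc (arc s) p w) (wc : Arc (arc s) w c) where

  open Shaped shaped

  A : Graph n
  A = arc s

  child-w : ∀ y → Arc A w y → y ≡ c
  child-w y wy = countF≡1⇒unique (A w) out-1 c y wc wy

  parent-w : ∀ y → Arc A y w → y ≡ p
  parent-w y yw = countF≡1⇒unique (λ y → A y w) in-1 p y pw yw

  -- w cannot have a degree kind of a network, so it is the parent of the leaf c.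
  parent-c : ∀ y → Arc A y c → y ≡ w
  parent-c y yc with local w alive-w
  ... | inj₁ kind = ⊥-elim (¬DegreeKind-1-1 (subst₂ DegreeKind in-1 out-1 kind))
  ... | inj₂ (_ , _ , c′ , wc′ , _ , in-1′) rewrite child-w c′ wc′ =
    countF≡1⇒unique (λ y → A y c) in-1′ w y wc yc

  open Suppression A acyclic pw wc parent-w child-w parent-c public

  ≢w : ∀ {v} → 2 ≤ outdeg A v → v ≢ w
  ≢w 2≤v refl = 1+n≰n (subst (2 ≤_) out-1 2≤v)

  kept : ∀ {v} → 2 ≤ outdeg A v → 2 ≤ outdeg B v
  kept 2≤v = subst (2 ≤_) (sym (outdeg-B _ (≢w 2≤v))) 2≤v

  clones-kept : ∀ {u v} → 2 ≤ outdeg A u → 2 ≤ outdeg A v → Clones A u v → Clones B u v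
  clones-kept 2≤u 2≤v =
    clones-transfer w σ-B σ-B-into-w (λ x x≢w leaf → trans (sym (outdeg-B x x≢w)) leaf) (≢w 2≤u) (≢w 2≤v)

  shaped-suppressed : Shaped KindOrPendant (suppress w p c s)
  shaped-suppressed = record { acyclic = acyclic-B ; arcs-alive = alive-ends ; local = local-B }
    where
      alive-ends : ∀ {u v} → Arc B u v → Alive (suppress w p c s) u × Alive (suppress w p c s) v
      alive-ends {u} {v} uv with B-cases uv
      ... | inj₂ (refl , refl) = delV-alive s p≢w (proj₁ (arcs-alive pw)) , delV-alive s (≢-sym w≢c) (proj₂ (arcs-alive wc))
      ... | inj₁ uv′ = delV-alive s (λ { refl → false≢true (trans (sym (B-from-w v)) uv) }) (proj₁ (arcs-alive uv′))
                     , delV-alive s (λ { refl → false≢true (trans (sym (B-into-w u)) uv) }) (proj₂ (arcs-alive uv′))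
      local-B : ∀ v → Alive (suppress w p c s) v → KindOrPendant B v
      local-B v alive-t with alive-delV s alive-t
      ... | v≢w , alive with local v alive
      ...   | inj₁ kind = inj₁ (DegreeKind-cong {A = A} {B} {v} (indeg-B v v≢w) (outdeg-B v v≢w) kind)
      ...   | inj₂ (in-1′ , out-1′ , c′ , vc′ , leaf , c′-in-1) =
        inj₂ (trans (indeg-B v v≢w) in-1′ , trans (outdeg-B v v≢w) out-1′ , c′ , A⊆B vc′ v≢w c′≢w ,
              trans (outdeg-B c′ c′≢w) leaf , trans (indeg-B c′ c′≢w) c′-in-1)
        where
          c′≢w : c′ ≢ w
          c′≢w refl = 1+n≢0 (trans (sym out-1) leaf)

suppress-all : ∀ {n} {s s′ : St n} → Shaped KindOrPendant s → SuppressAll s s′ → SuppressionResult s s′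
suppress-all shaped (finished no-1-1) = record
  { network     = record
      { acyclic    = acyclic
      ; arcs-alive = arcs-alive
      ; local      = λ v alive →
          [ (λ kind → kind) , (λ pend → ⊥-elim (no-1-1 v alive (proj₁ pend , proj₁ (proj₂ pend)))) ]′ (local v alive) }
  ; outdeg-kept = λ _ _ → refl
  ; clones-kept = λ _ _ clones → clones }
  where open Shaped shaped
suppress-all {s = s} {s′} shaped (supp w p c alive-w in-1 out-1 pw wc rest) = record
  { network     = SuppressionResult.network result
  ; outdeg-kept = λ v 2≤v → trans (SuppressionResult.outdeg-kept result v (kept 2≤v)) (outdeg-B v (≢w 2≤v))
  ; clones-kept = λ 2≤u 2≤v clones →
      SuppressionResult.clones-kept result (kept 2≤u) (kept 2≤v) (clones-kept 2≤u 2≤v clones) }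
  where
    open SuppressionStep shaped alive-w in-1 out-1 pw wc
    result : SuppressionResult (suppress w p c s) s′
    result = suppress-all shaped-suppressed rest

module NetworkFacts {n : ℕ} {s : St n} (network : NetworkState s) where

  open Shaped network public

  A : Graph n
  A = arc s

  open PathCounts A acyclic

  kind-of-tail : ∀ {u v} → Arc A u v → Kind A u
  kind-of-tail uv = local _ (proj₁ (arcs-alive uv))

  two-children : ∀ {v a b} → a ≢ b → Arc A v a → Arc A v b → (indeg A v ≡ 0 ⊎ indeg A v ≡ 1) × outdeg A v ≡ 2
  two-children {v} {a} {b} a≢b va vb = branching-kind (kind-of-tail va) (two-true⇒2≤countF (A v) a b a≢b va vb)

  only-children : ∀ {v a b} → a ≢ b → Arc A v a → Arc A v b → ∀ y → Arc A v y → y ≡ a ⊎ y ≡ b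
  only-children {v} {a} {b} a≢b va vb y vy =
    countF≡2⇒one-of (A v) (proj₂ (two-children a≢b va vb)) a b y a≢b va vb vy

  indeg-leaf : ∀ {p b} → LeafS s b → Arc A p b → indeg A b ≡ 1
  indeg-leaf {p} {b} (alive-b , leaf) pb = leaf-kind (local b alive-b) leaf (true⇒1≤countF (λ y → A y b) p pb)

  only-parent-of-leaf : ∀ {p b} → LeafS s b → Arc A p b → ∀ y → Arc A y b → y ≡ p
  only-parent-of-leaf {p} {b} leaf-b pb y yb = countF≡1⇒unique (λ y → A y b) (indeg-leaf leaf-b pb) p y pb yb

  no-other-parent-of-leaf : ∀ {p b} → LeafS s b → Arc A p b → ∀ v → v ≢ p → A v b ≡ false
  no-other-parent-of-leaf {p} {b} leaf-b pb v v≢p with A v b in vb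
  ... | false = refl
  ... | true  = ⊥-elim (v≢p (only-parent-of-leaf leaf-b pb v vb))

  only-child-of-reticulation : ∀ {r b} → IsRet A r → Arc A r b → ∀ y → Arc A r y → y ≡ b
  only-child-of-reticulation {r} {b} ret rb y ry =
    countF≡1⇒unique (A r) (reticulation-kind (kind-of-tail rb) ret) b y rb ry

  -- P is the common top of a cherry or reticulated cherry {a, b}: its children
  -- are a and c, and c leads to b alone.
  cherry-top-unclonable : ∀ {P a b c} → a ≢ b → a ≢ c → LeafS s a → LeafS s b →
    Arc A P a → Arc A P c → Reach⁺ A P b → (∀ x → IsLeaf A x → σ A c x ≡ ⟦ x == b ⟧) →
    ∀ w → w ≢ P → 2 ≤ outdeg A w → ¬ Clones A P w
  cherry-top-unclonable {P} {a} {b} {c} a≢b a≢c leaf-a leaf-b Pa Pc P↝b σ-c w w≢P =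
    bounded-top-unclonable a≢b (proj₂ leaf-a) (proj₂ leaf-b) (only-parent-of-leaf leaf-a Pa) P↝b bound w≢P
    where
      bound : ∀ x → IsLeaf A x → σ A P x ≤ ⟦ x == a ⟧ + ⟦ x == b ⟧
      bound x leaf = ≤-reflexive (begin
        σ A P x                  ≡⟨ σ-two-children x a≢c Pa Pc (only-children a≢c Pa Pc) (arc⇒¬leaf {E = A} Pa leaf) ⟩
        σ A a x + σ A c x        ≡⟨ cong₂ _+_ (σ-leaf x (proj₂ leaf-a)) (σ-c x leaf) ⟩
        ⟦ a == x ⟧ + ⟦ x == b ⟧  ≡⟨ cong (_+ ⟦ x == b ⟧) (cong ⟦_⟧ (==-sym a x)) ⟩
        ⟦ x == a ⟧ + ⟦ x == b ⟧  ∎)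
        where open ≡-Reasoning

  σ-leaf-sym : ∀ {b} → IsLeaf A b → ∀ x → σ A b x ≡ ⟦ x == b ⟧
  σ-leaf-sym {b} leaf x = trans (σ-leaf x leaf) (cong ⟦_⟧ (==-sym b x))

ReflectsNoClonedBranching : ∀ {n} → St n → St n → Set
ReflectsNoClonedBranching s t = NoClonedBranching (arc t) → NoClonedBranching (arc s)

module CherryLeafDeletion {n : ℕ} {s : St n} (network : NetworkState s) {a b p : Fin n}
  (a≢b : a ≢ b) (leaf-a : LeafS s a) (leaf-b : LeafS s b) (pa : Arc (arc s) p a) (pb : Arc (arc s) p b) where

  open NetworkFacts network public
  open VertexDeletion A acyclic b (inj₁ (countF≡0⇒false (A b) (proj₂ leaf-b))) public

  p≢a : p ≢ a
  p≢a = arc-irreflexive acyclic pa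

  p≢b : p ≢ b
  p≢b = arc-irreflexive acyclic pb

  p-unclonable : ∀ w → w ≢ p → 2 ≤ outdeg A w → ¬ Clones A p w
  p-unclonable = cherry-top-unclonable a≢b a≢b leaf-a leaf-b pa pb (one pb) (λ x _ → σ-leaf-sym (proj₂ leaf-b) x)

  ≢b : ∀ {v} → 2 ≤ outdeg A v → v ≢ b
  ≢b 2≤v refl = 2≤outdeg⇒¬leaf {A = A} 2≤v (proj₂ leaf-b)

  indeg-kept : ∀ v → v ≢ b → indeg D v ≡ indeg A v
  indeg-kept v v≢b = indeg-D-kept v≢b (countF≡0⇒false (A b) (proj₂ leaf-b) v)

  outdeg-kept : ∀ {v} → v ≢ b → v ≢ p → outdeg D v ≡ outdeg A v
  outdeg-kept {v} v≢b v≢p = outdeg-D-kept v≢b (no-other-parent-of-leaf leaf-b pb v v≢p)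

  outdeg-p : outdeg D p ≡ 1
  outdeg-p = +-cancelʳ-≡ 1 (outdeg D p) 1
    (trans (cong (λ x → outdeg D p + ⟦ x ⟧) (sym pb)) (trans (outdeg-D p p≢b) (proj₂ (two-children a≢b pa pb))))

  leaf-kept : ∀ x → x ≢ b → IsLeaf D x → IsLeaf A x
  leaf-kept x x≢b leaf = case-≟ x p (λ { refl → ⊥-elim (1+n≢0 (trans (sym outdeg-p) leaf)) })
                                    (λ x≢p → trans (sym (outdeg-kept x≢b x≢p)) leaf)

  clones-kept : ∀ {u w} → 2 ≤ outdeg A u → 2 ≤ outdeg A w → Clones A u w → Clones D u w
  clones-kept 2≤u 2≤w = clones-transfer b σ-D σ-D-into-z leaf-kept (≢b 2≤u) (≢b 2≤w)

  kept : ∀ {v} → 2 ≤ outdeg A v → v ≢ p → 2 ≤ outdeg D v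
  kept 2≤v v≢p = subst (2 ≤_) (sym (outdeg-kept (≢b 2≤v) v≢p)) 2≤v

  shaped-after-deletion : ¬ (indeg A p ≡ 0) → Shaped KindOrPendant (delV b s)
  shaped-after-deletion p-not-root = record
    { acyclic    = acyclic-D
    ; arcs-alive = λ uv → delV-alive s (proj₁ (arc-D⇒≢z uv)) (proj₁ (arcs-alive (D⊆A uv)))
                        , delV-alive s (proj₂ (arc-D⇒≢z uv)) (proj₂ (arcs-alive (D⊆A uv)))
    ; local      = λ v alive → case-≟ v p (λ { refl → inj₂ pendant-p }) λ v≢p →
        inj₁ (DegreeKind-cong {A = A} {D} {v} (indeg-kept v (proj₁ (alive-delV s alive)))
                (outdeg-kept (proj₁ (alive-delV s alive)) v≢p) (local v (proj₂ (alive-delV s alive)))) }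
    where
      in-1 : indeg A p ≡ 1
      in-1 = [ (λ in-0 → ⊥-elim (p-not-root in-0)) , (λ in-1 → in-1) ]′ (proj₁ (two-children a≢b pa pb))
      pendant-p : PendantParent D p
      pendant-p = trans (indeg-kept p p≢b) in-1 , outdeg-p , a , trans (D≡A p a p≢b a≢b) pa
                , trans (outdeg-kept a≢b (≢-sym p≢a)) (proj₂ leaf-a) , trans (indeg-kept a a≢b) (indeg-leaf leaf-a pa)

module CherryRootDeletion {n : ℕ} {s : St n} (network : NetworkState s) {a b p : Fin n}
  (a≢b : a ≢ b) (leaf-a : LeafS s a) (leaf-b : LeafS s b) (pa : Arc (arc s) p a) (pb : Arc (arc s) p b)
  (p-root : indeg (arc s) p ≡ 0) where

  module D₁ = CherryLeafDeletion network a≢b leaf-a leaf-b pa pb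
  open NetworkFacts network

  p-no-in : ∀ u → D₁.D u p ≡ false
  p-no-in = countF≡0⇒false (λ u → D₁.D u p) (trans (D₁.indeg-kept p D₁.p≢b) p-root)

  module D₂ = VertexDeletion D₁.D D₁.acyclic-D p (inj₂ p-no-in)

  D₂ : Graph n
  D₂ = D₂.D

  outdeg₂-kept : ∀ {v} → v ≢ p → outdeg D₂ v ≡ outdeg D₁.D v
  outdeg₂-kept {v} v≢p = D₂.outdeg-D-kept v≢p (p-no-in v)

  indeg₂-kept : ∀ {v} → v ≢ p → v ≢ a → v ≢ b → indeg D₂ v ≡ indeg D₁.D v
  indeg₂-kept {v} v≢p v≢a v≢b = D₂.indeg-D-kept v≢p (trans (D₁.D≡A p v D₁.p≢b v≢b) not-child)
    where
      not-child : A p v ≡ false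
      not-child with A p v in pv
      ... | false = refl
      ... | true  = ⊥-elim ([ v≢a , v≢b ]′ (only-children a≢b pa pb v pv))

  outdeg-kept : ∀ {v} → v ≢ b → v ≢ p → outdeg D₂ v ≡ outdeg A v
  outdeg-kept v≢b v≢p = trans (outdeg₂-kept v≢p) (D₁.outdeg-kept v≢b v≢p)

  clones-kept : ∀ {u w} → u ≢ p → w ≢ p → 2 ≤ outdeg A u → 2 ≤ outdeg A w → Clones A u w → Clones D₂ u w
  clones-kept u≢p w≢p 2≤u 2≤w clones =
    clones-transfer p D₂.σ-D D₂.σ-D-into-z (λ x x≢p leaf → trans (sym (outdeg₂-kept x≢p)) leaf) u≢p w≢p
      (D₁.clones-kept 2≤u 2≤w clones)

  a-isolated : Kind D₂ a
  a-isolated = inj₂ (inj₁ (in-0 , subst (_≤ 2) (sym (trans (outdeg-kept a≢b (≢-sym D₁.p≢a)) (proj₂ leaf-a))) z≤n))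
    where
      in-0 : indeg D₂ a ≡ 0
      in-0 = +-cancelʳ-≡ 1 (indeg D₂ a) 0
        (trans (cong (λ x → indeg D₂ a + ⟦ x ⟧) (sym (trans (D₁.D≡A p a D₁.p≢b a≢b) pa)))
               (trans (D₂.indeg-D a (≢-sym D₁.p≢a)) (trans (D₁.indeg-kept a a≢b) (indeg-leaf leaf-a pa))))

  network-after-deletion : NetworkState (delV p (delV b s))
  network-after-deletion = record
    { acyclic    = D₂.acyclic-D
    ; arcs-alive = λ uv → alive-ends (D₂.arc-D⇒≢z uv) (D₁.arc-D⇒≢z (D₂.D⊆A uv))
                                     (arcs-alive (D₁.D⊆A (D₂.D⊆A uv)))
    ; local      = λ v alive → local-D₂ (alive-delV (delV b s) alive) }
    where
      alive-ends : ∀ {u v} → u ≢ p × v ≢ p → u ≢ b × v ≢ b → Alive s u × Alive s v →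
                   Alive (delV p (delV b s)) u × Alive (delV p (delV b s)) v
      alive-ends (u≢p , v≢p) (u≢b , v≢b) (alive-u , alive-v) =
        delV-alive (delV b s) u≢p (delV-alive s u≢b alive-u) , delV-alive (delV b s) v≢p (delV-alive s v≢b alive-v)
      local-D₂ : ∀ {v} → v ≢ p × Alive (delV b s) v → Kind D₂ v
      local-D₂ {v} (v≢p , alive) with alive-delV s alive
      ... | v≢b , alive-s = case-≟ v a (λ { refl → a-isolated }) λ v≢a →
        DegreeKind-cong {A = A} {D₂} {v} (trans (indeg₂-kept v≢p v≢a v≢b) (D₁.indeg-kept v v≢b))
                        (outdeg-kept v≢b v≢p) (local v alive-s)

reduce-cherry : ∀ {n} {s t : St n} → NetworkState s → ∀ a b p → a ≢ b → LeafS s a → LeafS s b →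
  Arc (arc s) p a → Arc (arc s) p b → ¬ (indeg (arc s) p ≡ 0) → SuppressAll (delV b s) t →
  NetworkState t × ReflectsNoClonedBranching s t
reduce-cherry {s = s} {t} network a b p a≢b leaf-a leaf-b pa pb p-not-root suppression =
  SuppressionResult.network result ,
  no-cloned-branching-reflect p p-unclonable
    (λ u u≢p 2≤u → trans (SuppressionResult.outdeg-kept result u (kept 2≤u u≢p)) (outdeg-kept (≢b 2≤u) u≢p))
    (λ u≢p w≢p 2≤u 2≤w clones →
       SuppressionResult.clones-kept result (kept 2≤u u≢p) (kept 2≤w w≢p) (clones-kept 2≤u 2≤w clones))
  where
    open CherryLeafDeletion network a≢b leaf-a leaf-b pa pb
    result : SuppressionResult (delV b s) t
    result = suppress-all (shaped-after-deletion p-not-root) suppression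

reduce-cherry-at-root : ∀ {n} {s : St n} → NetworkState s → ∀ a b p → a ≢ b → LeafS s a → LeafS s b →
  Arc (arc s) p a → Arc (arc s) p b → indeg (arc s) p ≡ 0 →
  NetworkState (delV p (delV b s)) × ReflectsNoClonedBranching s (delV p (delV b s))
reduce-cherry-at-root network a b p a≢b leaf-a leaf-b pa pb p-root =
  network-after-deletion ,
  no-cloned-branching-reflect p D₁.p-unclonable (λ u u≢p 2≤u → outdeg-kept (D₁.≢b 2≤u) u≢p) clones-kept
  where open CherryRootDeletion network a≢b leaf-a leaf-b pa pb p-root

module ReticulatedCherryCut {n : ℕ} {s : St n} (network : NetworkState s) {a b pa pb : Fin n}
  (a≢b : a ≢ b) (leaf-a : LeafS s a) (leaf-b : LeafS s b)
  (pa-a : Arc (arc s) pa a) (pb-b : Arc (arc s) pb b) (ret-pb : IsRet (arc s) pb) (pa-pb : Arc (arc s) pa pb) where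

  open NetworkFacts network public
  open ArcDeletion A acyclic pa pb pa-pb public

  pa≢a : pa ≢ a
  pa≢a = arc-irreflexive acyclic pa-a

  pa≢pb : pa ≢ pb
  pa≢pb = arc-irreflexive acyclic pa-pb

  pb≢b : pb ≢ b
  pb≢b = arc-irreflexive acyclic pb-b

  a≢pb : a ≢ pb
  a≢pb = ≢-sym (arc⇒¬leaf {E = A} pb-b (proj₂ leaf-a))

  only-child-pb : ∀ y → Arc A pb y → y ≡ b
  only-child-pb = only-child-of-reticulation ret-pb pb-b

  pa-unclonable : ∀ w → w ≢ pa → 2 ≤ outdeg A w → ¬ Clones A pa w
  pa-unclonable = cherry-top-unclonable a≢b a≢pb leaf-a leaf-b pa-a pa-pb (cons pa-pb (one pb-b)) σ-pb
    where
      σ-pb : ∀ x → IsLeaf A x → σ A pb x ≡ ⟦ x == b ⟧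
      σ-pb x leaf = trans (σA.σ-only-child x pb-b only-child-pb (arc⇒¬leaf {E = A} pb-b leaf)) (σ-leaf-sym (proj₂ leaf-b) x)

  outdeg-pa : outdeg D pa ≡ 1
  outdeg-pa = +-cancelʳ-≡ 1 (outdeg D pa) 1 (trans outdeg-D-p (proj₂ (two-children a≢pb pa-a pa-pb)))

  D-pa-a : Arc D pa a
  D-pa-a = trans (D≡A pa a (λ e → a≢pb (proj₂ e))) pa-a

  D-pb-b : Arc D pb b
  D-pb-b = trans (D≡A pb b (λ e → pa≢pb (sym (proj₁ e)))) pb-b

  outdeg-a : outdeg D a ≡ 0
  outdeg-a = trans (outdeg-D a (≢-sym pa≢a)) (proj₂ leaf-a)

  outdeg-b : outdeg D b ≡ 0
  outdeg-b = trans (outdeg-D b (λ { refl → arc⇒¬leaf {E = A} pa-pb (proj₂ leaf-b) refl })) (proj₂ leaf-b)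

  -- After the cut, pb leads to b alone, so the paths from v to a are those through pa.
  σ-into-a : ∀ v → v ≢ a → σ A v a ≡ σ D v pa
  σ-into-a v v≢a = begin
    σ A v a                          ≡⟨ σ-split a v ⟩
    σ D v a + σ D v pa * σ D pb a    ≡⟨ cong (λ k → σ D v a + σ D v pa * k) σ-D-pb-a ⟩
    σ D v a + σ D v pa * 0           ≡⟨ cong (σ D v a +_) (*-zeroʳ (σ D v pa)) ⟩
    σ D v a + 0                      ≡⟨ +-identityʳ _ ⟩
    σ D v a                          ≡⟨ σD.σ-via-only-parent D-pa-a (λ y ya → only-parent-of-leaf leaf-a pa-a y (D⊆A ya)) v ⟩
    σ D v pa + ⟦ v == a ⟧            ≡⟨ cong (λ b → σ D v pa + ⟦ b ⟧) (==-≢ v≢a) ⟩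
    σ D v pa + 0                     ≡⟨ +-identityʳ _ ⟩
    σ D v pa                         ∎
    where
      open ≡-Reasoning
      σ-D-pb-a : σ D pb a ≡ 0
      σ-D-pb-a = trans (σD.σ-only-child a D-pb-b (λ y pby → only-child-pb y (D⊆A pby)) (≢-sym a≢pb))
                       (trans (σD.σ-leaf a outdeg-b) (cong ⟦_⟧ (==-≢ (≢-sym a≢b))))

  -- Both sides of σ-split carry the same term σ(·, a) · σ_D(pb, x), which cancels.
  clones-kept : ∀ {u w} → u ≢ a → w ≢ a → Clones A u w → Clones D u w
  clones-kept {u} {w} u≢a w≢a clones x leaf = +-cancelʳ-≡ (σ A u a * σ D pb x) (σ D u x) (σ D w x) (begin
    σ D u x + σ A u a * σ D pb x     ≡⟨ cong (λ k → σ D u x + k * σ D pb x) (σ-into-a u u≢a) ⟩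
    σ D u x + σ D u pa * σ D pb x    ≡⟨ sym (σ-split x u) ⟩
    σ A u x                          ≡⟨ clones x leaf-A ⟩
    σ A w x                          ≡⟨ σ-split x w ⟩
    σ D w x + σ D w pa * σ D pb x    ≡⟨ cong (λ k → σ D w x + k * σ D pb x) (sym (σ-into-a w w≢a)) ⟩
    σ D w x + σ A w a * σ D pb x     ≡⟨ cong (λ k → σ D w x + k * σ D pb x) (sym (clones a (proj₂ leaf-a))) ⟩
    σ D w x + σ A u a * σ D pb x     ∎)
    where
      open ≡-Reasoning
      leaf-A : IsLeaf A x
      leaf-A = case-≟ x pa (λ { refl → ⊥-elim (1+n≢0 (trans (sym outdeg-pa) leaf)) })
                           (λ x≢pa → trans (sym (outdeg-D x x≢pa)) leaf)

  ≢a : ∀ {v} → 2 ≤ outdeg A v → v ≢ a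
  ≢a 2≤v refl = 2≤outdeg⇒¬leaf {A = A} 2≤v (proj₂ leaf-a)

  kept : ∀ {v} → 2 ≤ outdeg A v → v ≢ pa → 2 ≤ outdeg D v
  kept {v} 2≤v v≢pa = subst (2 ≤_) (sym (outdeg-D v v≢pa)) 2≤v

  local-pa : KindOrPendant D pa
  local-pa with proj₁ (two-children a≢pb pa-a pa-pb)
  ... | inj₁ in-0 = inj₁ (inj₂ (inj₁ (trans (indeg-D pa pa≢pb) in-0 , subst (_≤ 2) (sym outdeg-pa) (s≤s z≤n))))
  ... | inj₂ in-1 = inj₂ (trans (indeg-D pa pa≢pb) in-1 , outdeg-pa , a , D-pa-a , outdeg-a ,
                          trans (indeg-D a a≢pb) (indeg-leaf leaf-a pa-a))

  outdeg-pb : outdeg D pb ≡ 1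
  outdeg-pb = trans (outdeg-D pb (≢-sym pa≢pb)) (reticulation-kind (kind-of-tail pb-b) ret-pb)

  local-pb : KindOrPendant D pb
  local-pb with indeg D pb in in-D
  ... | zero        = ⊥-elim (1+n≰n (subst (2 ≤_) (trans (sym indeg-D-q) (cong (_+ 1) in-D)) ret-pb))
  ... | suc zero    = inj₂ (refl , outdeg-pb , b , D-pb-b , outdeg-b , trans (indeg-D b (≢-sym pb≢b)) (indeg-leaf leaf-b pb-b))
  ... | suc (suc _) = inj₁ (inj₂ (inj₂ (inj₂ (s≤s (s≤s z≤n) , outdeg-pb))))

  shaped-after-cut : Shaped KindOrPendant (delA pa pb s)
  shaped-after-cut = record { acyclic = acyclic-D ; arcs-alive = λ uv → arcs-alive (D⊆A uv) ; local = local-D }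
    where
      local-D : ∀ v → Alive s v → KindOrPendant D v
      local-D v alive = case-≟ v pa (λ { refl → local-pa }) λ v≢pa → case-≟ v pb (λ { refl → local-pb }) λ v≢pb →
        inj₁ (DegreeKind-cong {A = A} {D} {v} (indeg-D v v≢pb) (outdeg-D v v≢pa) (local v alive))

reduce-cut : ∀ {n} {s t : St n} → NetworkState s → ∀ a b pa pb → a ≢ b → LeafS s a → LeafS s b →
  Arc (arc s) pa a → Arc (arc s) pb b → IsRet (arc s) pb → Arc (arc s) pa pb →
  SuppressAll (delA pa pb s) t → NetworkState t × ReflectsNoClonedBranching s t
reduce-cut {s = s} {t} network a b pa pb a≢b leaf-a leaf-b pa-a pb-b ret-pb pa-pb suppression =
  SuppressionResult.network result ,
  no-cloned-branching-reflect pa pa-unclonable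
    (λ u u≢pa 2≤u → trans (SuppressionResult.outdeg-kept result u (kept 2≤u u≢pa)) (outdeg-D u u≢pa))
    (λ u≢pa w≢pa 2≤u 2≤w clones → SuppressionResult.clones-kept result (kept 2≤u u≢pa) (kept 2≤w w≢pa)
       (clones-kept (≢a 2≤u) (≢a 2≤w) clones))
  where
    open ReticulatedCherryCut network a≢b leaf-a leaf-b pa-a pb-b ret-pb pa-pb
    result : SuppressionResult (delA pa pb s) t
    result = suppress-all shaped-after-cut suppression

reduce-step : ∀ {n} {s t : St n} → NetworkState s → Reduce s t → NetworkState t × ReflectsNoClonedBranching s t
reduce-step network (cherry a b p a≢b leaf-a leaf-b pa pb p-not-root suppression) =
  reduce-cherry network a b p a≢b leaf-a leaf-b pa pb p-not-root suppression
reduce-step network (cherryRoot a b p a≢b leaf-a leaf-b pa pb p-root) =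
  reduce-cherry-at-root network a b p a≢b leaf-a leaf-b pa pb p-root
reduce-step network (cut a b pa pb a≢b leaf-a leaf-b pa-a pb-b ret-pb pa-pb suppression) =
  reduce-cut network a b pa pb a≢b leaf-a leaf-b pa-a pb-b ret-pb pa-pb suppression

reduces-to-single⇒no-cloned-branching : ∀ {n} {s f : St n} → Reduces s f → SingleVertex f →
  NetworkState s → NoClonedBranching (arc s)
reduces-to-single⇒no-cloned-branching {s = s} [] (v , _ , only-v) network u w u≢w 2≤u 2≤w _ =
  u≢w (trans (only-v u (branching-alive 2≤u)) (sym (only-v w (branching-alive 2≤w))))
  where
    branching-alive : ∀ {x} → 2 ≤ outdeg (arc s) x → Alive s x
    branching-alive 2≤x = proj₁ (Shaped.arcs-alive network (proj₂ (2≤outdeg⇒arc {A = arc s} 2≤x)))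
reduces-to-single⇒no-cloned-branching (first ∷ rest) single network with reduce-step network first
... | network′ , reflect = reflect (reduces-to-single⇒no-cloned-branching rest single network′)

phyloNet-kind : ∀ {n} (E : Graph n) → IsPhyloNet E → ∀ v → Kind E v
phyloNet-kind E (_ , inj₁ (_ , no-arcs)) v =
  inj₂ (inj₁ (all-false⇒countF≡0 _ (λ u → no-arcs u v) , subst (_≤ 2) (sym (all-false⇒countF≡0 _ (no-arcs v))) z≤n))
phyloNet-kind E (_ , inj₂ (ρ , in-0 , out-2 , others)) v = case-≟ v ρ (λ { refl → inj₂ (inj₁ (in-0 , ≤-reflexive out-2)) })
  λ v≢ρ → [ (λ { (out-0 , in-1) → inj₁ (in-1 , out-0) }) , (λ kind → inj₂ (inj₂ kind)) ]′ (others v v≢ρ)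

phyloNet-non-reticulation : ∀ {n} (E : Graph n) → IsPhyloNet E → ∀ v → ¬ IsRet E v → IsLeaf E v ⊎ 2 ≤ outdeg E v
phyloNet-non-reticulation E (_ , inj₁ (_ , no-arcs)) v ¬ret = inj₁ (all-false⇒countF≡0 (E v) (no-arcs v))
phyloNet-non-reticulation E (_ , inj₂ (ρ , _ , out-2 , others)) v ¬ret =
  case-≟ v ρ (λ { refl → inj₂ (≤-reflexive (sym out-2)) }) λ v≢ρ →
  [ (λ leaf → inj₁ (proj₁ leaf))
  , [ (λ tree → inj₂ (≤-reflexive (sym (proj₂ tree)))) , (λ ret → ⊥-elim (¬ret (proj₁ ret))) ]′
  ]′ (others v v≢ρ)

initial-network : ∀ {n} (E : Graph n) → IsPhyloNet E → NetworkState (initSt E)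
initial-network E phylo = record
  { acyclic    = proj₁ phylo
  ; arcs-alive = λ _ → refl , refl
  ; local      = λ v _ → phyloNet-kind E phylo v }

orchard⇒no-cloned-branching : ∀ {n} (E : Graph n) → IsOrchard E → NoClonedBranching E
orchard⇒no-cloned-branching E (phylo , _ , steps , single) =
  reduces-to-single⇒no-cloned-branching steps single (initial-network E phylo)

module _ {n : ℕ} {E : Graph n} where

  clones-sym : ∀ {u w} → Clones E u w → Clones E w u
  clones-sym clones x leaf = sym (clones x leaf)

  clones-trans : ∀ {u v w} → Clones E u v → Clones E v w → Clones E u w
  clones-trans uv vw x leaf = trans (uv x leaf) (vw x leaf)

  ~′-sym : ∀ {u v} → _~'_ E u v → _~'_ E v u
  ~′-sym (ret-u , ret-v , arc) = ret-v , ret-u , [ inj₂ , inj₁ ]′ arc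

  sameSink-snoc : ∀ {u v w} → SameSink E u v → _~'_ E v w → SameSink E u w
  sameSink-snoc refl'       vw = step vw refl'
  sameSink-snoc (step uy r) vw = step uy (sameSink-snoc r vw)

  sameSink-sym : ∀ {u v} → SameSink E u v → SameSink E v u
  sameSink-sym refl'       = refl'
  sameSink-sym (step uy r) = sameSink-snoc (sameSink-sym r) (~′-sym uy)

  sameSink-trans : ∀ {u v w} → SameSink E u v → SameSink E v w → SameSink E u w
  sameSink-trans refl'       vw = vw
  sameSink-trans (step uy r) vw = step uy (sameSink-trans r vw)

  data Descent : Fin n → Fin n → Set where
    stop : ∀ {v} → ¬ IsRet E v → Descent v v
    down : ∀ {u c t} → IsRet E u → Arc E u c → Descent c t → Descent u t

  descent-end : ∀ {v t} → Descent v t → ¬ IsRet E t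
  descent-end (stop ¬ret)     = ¬ret
  descent-end (down _ _ rest) = descent-end rest

  descent-last : ∀ {u t} → IsRet E u → Descent u t → Σ _ (λ k → IsRet E k × SameSink E u k × Arc E k t)
  descent-last ret (stop ¬ret)                          = ⊥-elim (¬ret ret)
  descent-last ret (down _ uc (stop _))                 = _ , ret , refl' , uc
  descent-last ret (down _ uc (down ret-c cd rest)) with descent-last ret-c (down ret-c cd rest)
  ... | k , ret-k , c∼k , kt = k , ret-k , step (ret , ret-c , inj₁ uc) c∼k , kt

module Network {n : ℕ} (E : Graph n) (phylo : IsPhyloNet E) where

  acyclic : Acyclic E
  acyclic = proj₁ phylo

  open PathCounts E acyclic

  only-child-of-reticulation : ∀ {u v} → IsRet E u → Arc E u v → ∀ y → Arc E u y → y ≡ v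
  only-child-of-reticulation {u} {v} ret uv y uy =
    countF≡1⇒unique (E u) (reticulation-kind (phyloNet-kind E phylo u) ret) v y uv uy

  reticulation-clones-child : ∀ {u v} → IsRet E u → Arc E u v → Clones E u v
  reticulation-clones-child ret uv x leaf =
    σ-only-child x uv (only-child-of-reticulation ret uv) (arc⇒¬leaf {E = E} uv leaf)

  sameSink⇒clones : ∀ {u v} → SameSink E u v → Clones E u v
  sameSink⇒clones refl'                           x leaf = refl
  sameSink⇒clones (step (ret-u , _ , inj₁ uy) r) = clones-trans (reticulation-clones-child ret-u uy) (sameSink⇒clones r)
  sameSink⇒clones (step (_ , ret-y , inj₂ yu) r) =
    clones-trans (clones-sym (reticulation-clones-child ret-y yu)) (sameSink⇒clones r)

  descent-clones : ∀ {v t} → Descent {E = E} v t → Clones E v t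
  descent-clones (stop _)         x leaf = refl
  descent-clones (down ret uc rest) = clones-trans (reticulation-clones-child ret uc) (descent-clones rest)

  descent-exists : ∀ v → Σ _ (Descent {E = E} v)
  descent-exists v with descent-or-walk n v
    where
      descent-or-walk : ∀ k v → Σ _ (Descent {E = E} v) ⊎ Walk {E = E} k v
      descent-or-walk zero    v = inj₂ []
      descent-or-walk (suc k) v with 2 ≤? indeg E v
      ... | no ¬ret = inj₁ (v , stop ¬ret)
      ... | yes ret with 1≤countF⇒true (E v) (≤-reflexive (sym (reticulation-kind (phyloNet-kind E phylo v) ret)))
      ...   | c , vc with descent-or-walk k c
      ...     | inj₁ (t , rest) = inj₁ (t , down ret vc rest)
      ...     | inj₂ W          = inj₂ (vc ∷ W)
  ... | inj₁ found = found
  ... | inj₂ W     = ⊥-elim (acyclic⇒no-walk acyclic W)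

  non-reticulation : ∀ v → ¬ IsRet E v → IsLeaf E v ⊎ 2 ≤ outdeg E v
  non-reticulation = phyloNet-non-reticulation E phylo

  -- Both children of w reach leaves, which must be x, so σ(w, x) ≥ 2 > σ(x, x).
  leaf-unclonable : ∀ {x w} → IsLeaf E x → 2 ≤ outdeg E w → ¬ Clones E x w
  leaf-unclonable {x} {w} leaf 2≤out clones with 2≤countF⇒two-true (E w) 2≤out
  ... | c₁ , c₂ , c₁≢c₂ , wc₁ , wc₂ = 1+n≰n (begin
    2                     ≤⟨ +-mono-≤ (child-reaches-x wc₁) (child-reaches-x wc₂) ⟩
    σ E c₁ x + σ E c₂ x   ≤⟨ σ-two-children-≤ x c₁≢c₂ wc₁ wc₂ ⟩
    σ E w x               ≡⟨ sym (clones x leaf) ⟩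
    σ E x x               ≡⟨ σ-leaf x leaf ⟩
    ⟦ x == x ⟧            ≡⟨ cong ⟦_⟧ (==-refl x) ⟩
    1                     ∎)
    where
      open ≤-Reasoning
      child-reaches-x : ∀ {c} → Arc E w c → 1 ≤ σ E c x
      child-reaches-x {c} wc with leaf-below c
      ... | y , leaf-y , 1≤σ = case-≟ y x (λ { refl → 1≤σ }) λ y≢x → ⊥-elim (1+n≰n (begin
        1          ≤⟨ ≤-trans 1≤σ (σ-arc-≤ y wc) ⟩
        σ E w y    ≡⟨ sym (clones y leaf-y) ⟩
        σ E x y    ≡⟨ σ-leaf y leaf ⟩
        ⟦ x == y ⟧ ≡⟨ cong ⟦_⟧ (==-≢ (≢-sym y≢x)) ⟩
        0          ∎))

  leaves-unclonable : ∀ {x y} → IsLeaf E x → IsLeaf E y → x ≢ y → ¬ Clones E x y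
  leaves-unclonable {x} {y} leaf-x leaf-y x≢y clones = 1+n≢0 (begin
    1            ≡⟨ sym (cong ⟦_⟧ (==-refl x)) ⟩
    ⟦ x == x ⟧   ≡⟨ sym (σ-leaf x leaf-x) ⟩
    σ E x x      ≡⟨ clones x leaf-x ⟩
    σ E y x      ≡⟨ σ-leaf x leaf-y ⟩
    ⟦ y == x ⟧   ≡⟨ cong ⟦_⟧ (==-≢ (≢-sym x≢y)) ⟩
    0            ∎)
    where open ≡-Reasoning

  non-reticulation-clones⇒≡ : IsOrchard E → ∀ {t₁ t₂} → ¬ IsRet E t₁ → ¬ IsRet E t₂ →
                              Clones E t₁ t₂ → t₁ ≡ t₂
  non-reticulation-clones⇒≡ orchard {t₁} {t₂} ¬ret₁ ¬ret₂ clones =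
    case-≟ t₁ t₂ (λ t₁≡t₂ → t₁≡t₂) λ t₁≢t₂ →
      ⊥-elim (unclonable t₁≢t₂ (non-reticulation t₁ ¬ret₁) (non-reticulation t₂ ¬ret₂))
    where
      unclonable : t₁ ≢ t₂ → IsLeaf E t₁ ⊎ 2 ≤ outdeg E t₁ → IsLeaf E t₂ ⊎ 2 ≤ outdeg E t₂ → ⊥
      unclonable t₁≢t₂ (inj₁ leaf₁) (inj₁ leaf₂) = leaves-unclonable leaf₁ leaf₂ t₁≢t₂ clones
      unclonable t₁≢t₂ (inj₁ leaf₁) (inj₂ 2≤₂)   = leaf-unclonable leaf₁ 2≤₂ clones
      unclonable t₁≢t₂ (inj₂ 2≤₁)   (inj₁ leaf₂) = leaf-unclonable leaf₂ 2≤₁ (clones-sym clones)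
      unclonable t₁≢t₂ (inj₂ 2≤₁)   (inj₂ 2≤₂)   =
        orchard⇒no-cloned-branching E orchard t₁ t₂ t₁≢t₂ 2≤₁ 2≤₂ clones

  only-parent-of-non-reticulation : ∀ {k t} → ¬ IsRet E t → Arc E k t → ∀ y → Arc E y t → y ≡ k
  only-parent-of-non-reticulation {k} {t} ¬ret kt y yt = countF≡1⇒unique (λ y → E y t) in-1 k y kt yt
    where
      in-1 : indeg E t ≡ 1
      in-1 with indeg E t in eq
      ... | zero        = ⊥-elim (1+n≰n (subst (1 ≤_) eq (true⇒1≤countF (λ y → E y t) k kt)))
      ... | suc zero    = refl
      ... | suc (suc _) = ⊥-elim (¬ret (s≤s (s≤s z≤n)))

  CloneCondition : Fin n → Fin n → Set
  CloneCondition i j =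
      SameSink E i j
    ⊎ (IsRet E i × ¬ IsRet E j × Σ (Fin n) (λ k → IsRet E k × SameSink E i k × Arc E k j))
    ⊎ (IsRet E j × ¬ IsRet E i × Σ (Fin n) (λ k → IsRet E k × SameSink E j k × Arc E k i))

  cloneCondition⇒clones : ∀ {i j} → CloneCondition i j → Clones E i j
  cloneCondition⇒clones (inj₁ i∼j) = sameSink⇒clones i∼j
  cloneCondition⇒clones (inj₂ (inj₁ (_ , _ , k , ret-k , i∼k , kj))) =
    clones-trans (sameSink⇒clones i∼k) (reticulation-clones-child ret-k kj)
  cloneCondition⇒clones (inj₂ (inj₂ (_ , _ , k , ret-k , j∼k , ki))) =
    clones-sym (clones-trans (sameSink⇒clones j∼k) (reticulation-clones-child ret-k ki))

  common-descent⇒cloneCondition : ∀ {i j t} → i ≢ j → Descent {E = E} i t → Descent {E = E} j t →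
                                  CloneCondition i j
  common-descent⇒cloneCondition i≢j (stop _) (stop _) = ⊥-elim (i≢j refl)
  common-descent⇒cloneCondition i≢j (stop ¬ret-i) dj@(down ret-j _ _) =
    inj₂ (inj₂ (ret-j , ¬ret-i , descent-last ret-j dj))
  common-descent⇒cloneCondition i≢j di@(down ret-i _ _) (stop ¬ret-j) =
    inj₂ (inj₁ (ret-i , ¬ret-j , descent-last ret-i di))
  common-descent⇒cloneCondition i≢j di@(down ret-i _ _) dj@(down ret-j _ _)
    with descent-last ret-i di | descent-last ret-j dj
  ... | kᵢ , _ , i∼kᵢ , kᵢt | kⱼ , _ , j∼kⱼ , kⱼt
    rewrite only-parent-of-non-reticulation (descent-end di) kᵢt kⱼ kⱼt =
      inj₁ (sameSink-trans i∼kᵢ (sameSink-sym j∼kⱼ))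

lemma4p4 : ∀ {n : ℕ} (E : Graph n) → IsOrchard E →
    ∀ (i j : Fin n) → ¬ IsLeaf E i → ¬ IsLeaf E j → i ≢ j →
    Clones E i j ⇔
      ( SameSink E i j
      ⊎ (IsRet E i × ¬ IsRet E j ×
           Σ (Fin n) (λ k → IsRet E k × SameSink E i k × Arc E k j))
      ⊎ (IsRet E j × ¬ IsRet E i ×
           Σ (Fin n) (λ k → IsRet E k × SameSink E j k × Arc E k i)) )
lemma4p4 E orchard i j _ _ i≢j = mk⇔ clones⇒cloneCondition cloneCondition⇒clones
  where
    open Network E (proj₁ orchard)
    clones⇒cloneCondition : Clones E i j → CloneCondition i j
    clones⇒cloneCondition clones with descent-exists i | descent-exists j
    ... | tᵢ , dᵢ | tⱼ , dⱼ
      with non-reticulation-clones⇒≡ orchard (descent-end dᵢ) (descent-end dⱼ)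
             (clones-trans (clones-sym (descent-clones dᵢ)) (clones-trans clones (descent-clones dⱼ)))
    ... | refl = common-descent⇒cloneCondition i≢j dᵢ dⱼ
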